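{- With the notation of the context, $$L(P_0*(P_1,\dots,P_{m_0}))\ =\ \Big(\prod_{1\leq i\leq m_0} L(P_i)\Big)\cdot L(P_0*(P_{1,\mathrm{ch}},\dots,P_{m_0,\mathrm{ch}})).$$ Hence the same identity holds with $L$ everywhere replaced by $L_\pm$, or by $L_+$, or by $L_-$.
   Context: Let $P_0=(|P_0|,\preccurlyeq_0)$ be a finite poset with $|P_0|=\{x_1,\dots,x_{m_0}\}$, and for each $1\leq i\leq m_0$ let $P_i=(|P_i|,\preccurlyeq_i)$ be a finite poset with $|P_i|=\{x_{i,1},\dots,x_{i,m_i}\}$, where the symbols $x_{i,j}$ denote pairwise distinct elements. The lexicographic sum $P_0*(P_1,\dots,P_{m_0})=(|P|,\preccurlyeq)$ has underlying set $|P|=\{x_{i,j}\mid 1\leq i\leq m_0,\ 1\leq j\leq m_i\}$, with $x_{i,j}\preccurlyeq x_{i',j'}$ if and only if either $i\neq i'$ and $x_i\preccurlyeq_0 x_{i'}$, or $i=i'$ and $x_{i,j}\preccurlyeq_i x_{i,j'}$. Reference orders: on each $|P_i|$ take the linear order $x_{i,1}\preccurlyeq_{i,\mathrm{ch}}\dots\preccurlyeq_{i,\mathrm{ch}}x_{i,m_i}$ and write $P_{i,\mathrm{ch}}=(|P_i|,\preccurlyeq_{i,\mathrm{ch}})$ (a chain); on any lexicographic sum over $P_0$ with these underlying sets take the reference order $x_{1,1},\dots,x_{1,m_1},\dots,x_{m_0,1},\dots,x_{m_0,m_{m_0}}$. For a finite poset $Q$ with a fixed reference linear order, a linearization of $Q$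 is called even or odd according to whether the permutation carrying the reference order to it is even or odd; $L_0(Q)$ and $L_1(Q)$ denote the numbers of even and odd linearizations, and $L(Q)=L_0(Q)+L_1(Q)\,\zeta$ in the group ring $\mathbb{Z}\{1,\zeta\}$ of the two-element group $\{1,\zeta\}$. Further $L_+(Q)=L_0(Q)+L_1(Q)$ (the number of linearizations), $L_-(Q)=L_0(Q)-L_1(Q)$ (the sign-imbalance), and $L_\pm(Q)=(L_+(Q),L_-(Q))\in\mathbb{Z}\times\mathbb{Z}$, the image of $L(Q)$ under the ring embedding $\mathbb{Z}\{1,\zeta\}\to\mathbb{Z}\times\mathbb{Z}$ sending $\zeta\mapsto(1,-1)$. -}

module Defs where

open import Level using (0ℓ)
open import Data.Nat as ℕ using (ℕ; zero; suc; _%_)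
open import Data.Integer as ℤ using (ℤ; +_)
open import Data.Fin as Fin using (Fin; zero; suc; splitAt; _≤_; _<_; _≤?_; _<?_; _≟_)
open import Data.Fin.Properties using (≤-isPartialOrder)
open import Data.Product using (Σ; Σ-syntax; _×_; _,_; proj₁; proj₂)
open import Data.Sum using (_⊎_; inj₁; inj₂)
open import Data.List using (List; []; _∷_; length; filter; map; concatMap; cartesianProduct)
open import Data.Vec using (Vec; []; _∷_; lookup)
open import Data.Fin.Properties using (all?)
open import Function using (_∘_)
open import Relation.Binary using (Rel; Decidable; IsPartialOrder)
open import Relation.Binary.PropositionalEquality using (_≡_; _≢_; refl; subst)
open import Relation.Nullary using (Dec; yes; no; ¬_)
open import Relation.Nullary.Decidable using (_×-dec_; _→-dec_; _⊎-dec_; ¬?; map′)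

-- Finite posets: the underlying set of a poset with m elements is Fin m,
-- and the reference linear order is the natural order of Fin m
-- (element x_j  <->  index j).

record FinPoset (n : ℕ) : Set₁ where
  field
    _≼_            : Rel (Fin n) 0ℓ
    _≼?_           : Decidable _≼_
    isPartialOrder : IsPartialOrder _≡_ _≼_

-- A decidable relation on Fin n (used for the lexicographic sum; being a
-- partial order is not needed to define/count linearizations).
record DecRel (n : ℕ) : Set₁ where
  field
    rel  : Rel (Fin n) 0ℓ
    rel? : Decidable rel

poset→rel : ∀ {n} → FinPoset n → DecRel n
poset→rel P = record { rel = FinPoset._≼_ P ; rel? = FinPoset._≼?_ P }

chain : (n : ℕ) → FinPoset n
chain n = record { _≼_ = _≤_ ; _≼?_ = _≤?_ ; isPartialOrder = ≤-isPartialOrder }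

-- For P₀ on Fin m₀ and P_i on Fin (m i), the underlying
-- set { x_{i,j} } is encoded as Fin (total m₀ m), listed in the reference
-- order x_{1,1},…,x_{1,m_1},…,x_{m₀,1},…,x_{m₀,m_{m₀}}; `decode` gives (i , j).

total : (k : ℕ) → (Fin k → ℕ) → ℕ
total zero    m = 0
total (suc k) m = m zero ℕ.+ total k (m ∘ suc)

decode : (k : ℕ) (m : Fin k → ℕ) → Fin (total k m) → Σ (Fin k) (λ i → Fin (m i))
decode (suc k) m x with splitAt (m zero) x
... | inj₁ j = zero , j
... | inj₂ y with decode k (m ∘ suc) y
...   | i , j = suc i , j

lexRelΣ : ∀ {k} {m : Fin k → ℕ} → FinPoset k → ((i : Fin k) → FinPoset (m i)) →
          Rel (Σ (Fin k) (λ i → Fin (m i))) 0ℓ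
lexRelΣ {m = m} P₀ Ps (i , j) (i' , j') =
  (i ≢ i' × FinPoset._≼_ P₀ i i')
  ⊎ (Σ (i ≡ i') λ e → FinPoset._≼_ (Ps i') (subst (λ t → Fin (m t)) e j) j')

lexRelΣ? : ∀ {k} {m : Fin k → ℕ} (P₀ : FinPoset k) (Ps : (i : Fin k) → FinPoset (m i)) →
           Decidable (lexRelΣ {m = m} P₀ Ps)
lexRelΣ? P₀ Ps (i , j) (i' , j') with i ≟ i'
... | yes refl = map′ inj₂ (λ { (inj₁ (ne , _)) → Data.Empty.⊥-elim (ne refl) ; (inj₂ p) → p })
                      (map′ (refl ,_) (λ { (refl , p) → p }) (FinPoset._≼?_ (Ps i) j j'))
  where import Data.Empty
... | no ne = map′ (λ p → inj₁ (ne , p)) (λ { (inj₁ (_ , p)) → p ; (inj₂ (e , _)) → Data.Empty.⊥-elim (ne e) })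
                   (FinPoset._≼?_ P₀ i i')
  where import Data.Empty

lexSum : ∀ {k} {m : Fin k → ℕ} → FinPoset k → ((i : Fin k) → FinPoset (m i)) →
         DecRel (total k m)
lexSum {k} {m} P₀ Ps = record
  { rel  = λ x y → lexRelΣ P₀ Ps (decode k m x) (decode k m y)
  ; rel? = λ x y → lexRelΣ? P₀ Ps (decode k m x) (decode k m y) }

-- A linearization of a relation on Fin n is a listing
-- v = (v_0,…,v_{n-1}) of all elements (v injective, hence bijective)
-- such that v_p ≼ v_q implies p ≤ q.  The permutation carrying the
-- reference order to it is p ↦ v_p; its parity is that of its number of
-- inversions.

IsLinearization : ∀ {n} → DecRel n → Vec (Fin n) n → Set
IsLinearization R v =
  (∀ p q → lookup v p ≡ lookup v q → p ≡ q) ×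
  (∀ p q → DecRel.rel R (lookup v p) (lookup v q) → p ≤ q)

isLinearization? : ∀ {n} (R : DecRel n) → (v : Vec (Fin n) n) → Dec (IsLinearization R v)
isLinearization? R v =
  all? (λ p → all? (λ q → (lookup v p ≟ lookup v q) →-dec (p ≟ q))) ×-dec
  all? (λ p → all? (λ q → DecRel.rel? R (lookup v p) (lookup v q) →-dec (p ≤? q)))

allVecs : (n k : ℕ) → List (Vec (Fin k) n)
allVecs zero    k = [] ∷ []
allVecs (suc n) k = concatMap (λ x → map (x ∷_) (allVecs n k)) (Data.List.allFin k)
  where import Data.List

allFinL : (n : ℕ) → List (Fin n)
allFinL = Data.List.allFin
  where import Data.List

inversions : ∀ {n} → Vec (Fin n) n → ℕ
inversions {n} v =
  length (filter (λ pq → (proj₁ pq <? proj₂ pq) ×-dec (lookup v (proj₂ pq) <? lookup v (proj₁ pq)))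
                 (cartesianProduct (allFinL n) (allFinL n)))

IsEven : ∀ {n} → Vec (Fin n) n → Set
IsEven v = inversions v % 2 ≡ 0

isEven? : ∀ {n} (v : Vec (Fin n) n) → Dec (IsEven v)
isEven? v = inversions v % 2 ℕ.≟ 0

L₀ : ∀ {n} → DecRel n → ℕ
L₀ {n} R = length (filter (λ v → isLinearization? R v ×-dec isEven? v) (allVecs n n))

L₁ : ∀ {n} → DecRel n → ℕ
L₁ {n} R = length (filter (λ v → isLinearization? R v ×-dec ¬? (isEven? v)) (allVecs n n))

-- The group ring ℤ{1,ζ}: a + b ζ is represented by (a , b), with ζ² = 1.

ℤζ : Set
ℤζ = ℤ × ℤ

_·ζ_ : ℤζ → ℤζ → ℤζ
(a , b) ·ζ (c , d) = (a ℤ.* c ℤ.+ b ℤ.* d) , (a ℤ.* d ℤ.+ b ℤ.* c)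

oneζ : ℤζ
oneζ = + 1 , + 0

∏ζ : (k : ℕ) → (Fin k → ℤζ) → ℤζ
∏ζ zero    f = oneζ
∏ζ (suc k) f = f zero ·ζ ∏ζ k (f ∘ suc)

L : ∀ {n} → DecRel n → ℤζ
L R = + L₀ R , + L₁ R

L₊ : ∀ {n} → DecRel n → ℤ
L₊ R = + L₀ R ℤ.+ + L₁ R

L₋ : ∀ {n} → DecRel n → ℤ
L₋ R = + L₀ R ℤ.- + L₁ R

L± : ∀ {n} → DecRel n → ℤ × ℤ
L± R = L₊ R , L₋ R

∏ℤ : (k : ℕ) → (Fin k → ℤ) → ℤ
∏ℤ zero    f = + 1
∏ℤ (suc k) f = f zero ℤ.* ∏ℤ k (f ∘ suc)

_·²_ : ℤ × ℤ → ℤ × ℤ → ℤ × ℤ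
(a , b) ·² (c , d) = a ℤ.* c , b ℤ.* d

∏² : (k : ℕ) → (Fin k → ℤ × ℤ) → ℤ × ℤ
∏² zero    f = + 1 , + 1
∏² (suc k) f = f zero ·² ∏² k (f ∘ suc)

-- We count linearizations in the semiring ℕ[ζ] (pairs of naturals, ζ² = 1):
-- L(R) is the sum over all linearizations v of ζ^(number of inversions of v).
-- Sorting the linearizations by their first entry x gives the recursion
--   L(R) = ∑ₓ [x minimal] ζ^x L(R ∖ x),
-- because x in front of a listing of the other elements creates x inversions.
--
-- A lexicographic sum is a relation R on Fin n cut into consecutive blocks
-- that agrees, between distinct blocks, with a relation Q on the blocks; its
-- chain version C agrees with Q between blocks and is the natural order inside
-- them.  By induction on n we show L(R) = ∏ᵢ L(R on block i) · L(C): regroup the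
-- recursion by blocks and apply the induction hypothesis to the deletions R ∖ x,
-- C ∖ x, which are again of this form.  Inside block i only the first element
-- contributes for C, while for R the terms add up, by the recursion within the
-- block, to L(R on block i).  The result is then carried from ℕ[ζ] to ℤ{1,ζ},
-- and from there to ℤ along ζ ↦ 1 and ζ ↦ -1.

module Submission where

open import Defs
open import Data.Nat using (ℕ)
open import Data.Fin using (Fin)
open import Data.Product using (_×_)
import Data.Integer
open import Relation.Binary.PropositionalEquality using (_≡_)

open DecRel using (rel)

open import Level using (0ℓ)
open import Data.Nat as ℕ using (ℕ; zero; suc; _+_; _*_; _%_; z≤n; s≤s)
import Data.Nat.Properties as ℕP
open import Data.Nat.Tactic.RingSolver using (solve-∀)
open import Data.Integer as ℤ using (ℤ)
import Data.Integer.Properties as ℤP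
open import Data.Integer.Tactic.RingSolver using () renaming (solve-∀ to solveℤ)
open import Data.Fin as Fin using (Fin; zero; suc; toℕ; punchIn; punchOut; splitAt)
import Data.Fin.Properties as FinP
open import Data.Fin.Permutation using (permutation)
open import Data.Bool using (true; false; if_then_else_)
open import Data.Product using (∃; _×_; _,_; proj₁; proj₂; map₂)
open import Data.Sum using (inj₁; inj₂)
open import Data.List as List using (List; []; _∷_; _++_; map; concatMap; filter; length; allFin; cartesianProduct)
open import Data.List.Membership.Propositional using (_∈_; lose)
open import Data.List.Relation.Unary.Any using (here; there)
import Data.List.Membership.Propositional.Properties as ∈
open import Data.List.Membership.Propositional.Properties.WithK using (unique∧set⇒bag)
open import Data.List.Relation.Unary.Unique.Propositional using (Unique)
import Data.List.Relation.Unary.Unique.Propositional.Properties as Unique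
open import Data.List.Relation.Binary.BagAndSetEquality using (∼bag⇒↭)
open import Data.List.Relation.Binary.Permutation.Propositional using (_↭_; ↭⇒↭ₛ′)
import Data.List.Relation.Binary.Permutation.Propositional.Properties as ↭
import Data.List.Relation.Binary.Permutation.Setoid.Properties as PermSetoid
open import Data.Vec as Vec using (Vec; []; _∷_; lookup)
import Data.Vec.Properties as VecP
import Data.List.Relation.Unary.All as All
import Data.List.Relation.Unary.All.Properties as All
import Data.List.Relation.Unary.AllPairs as AllPairs
import Data.List.Relation.Unary.AllPairs.Properties as AllPairs
open import Data.List.Relation.Binary.Disjoint.Propositional using (Disjoint)
open import Function using (_∘_; id; mk⇔; _⟨_⟩_; _⇔_; Equivalence)
open import Function.Definitions using (Injective)
open import Relation.Binary.PropositionalEquality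
open import Algebra.Bundles using (CommutativeMonoid; CommutativeSemiring)
open import Algebra.Structures using (IsCommutativeMonoid; IsSemigroup)
open import Algebra.Structures.Biased using (isCommutativeMonoidˡ; isCommutativeSemiringˡ)
import Algebra.Properties.CommutativeMonoid.Sum as MonoidSum
open import Relation.Nullary using (Dec; yes; no; does; ¬_)
open import Relation.Nullary.Decidable using (_×-dec_; _→-dec_; ¬?)
open import Data.Empty using (⊥-elim)
open import Data.Unit using (⊤; tt)
open import Relation.Unary using (Pred; Decidable)

-- The semiring ℕ[ζ]: the pair (a , b) stands for a + bζ, where ζ² = 1.

ℕ[ζ] : Set
ℕ[ζ] = ℕ × ℕ

infixl 6 _⊕_
infixl 7 _⊗_

_⊕_ : ℕ[ζ] → ℕ[ζ] → ℕ[ζ]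
(a , b) ⊕ (c , d) = a + c , b + d

_⊗_ : ℕ[ζ] → ℕ[ζ] → ℕ[ζ]
(a , b) ⊗ (c , d) = a * c + b * d , a * d + b * c

𝟘 𝟙 ζ : ℕ[ζ]
𝟘 = 0 , 0
𝟙 = 1 , 0
ζ = 0 , 1

ℕ[ζ]-commutativeSemiring : CommutativeSemiring 0ℓ 0ℓ
ℕ[ζ]-commutativeSemiring = record
  { _+_ = _⊕_ ; _*_ = _⊗_ ; 0# = 𝟘 ; 1# = 𝟙
  ; isCommutativeSemiring = isCommutativeSemiringˡ (record
      { +-isCommutativeMonoid = isCommutativeMonoidˡ (record
          { isSemigroup = semigroup _⊕_ ⊕-assoc ; identityˡ = λ _ → refl ; comm = ⊕-comm })
      ; *-isCommutativeMonoid = isCommutativeMonoidˡ (record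
          { isSemigroup = semigroup _⊗_ ⊗-assoc ; identityˡ = ⊗-identityˡ ; comm = ⊗-comm })
      ; distribʳ = ⊗-distribʳ
      ; zeroˡ    = λ _ → refl })
  }
  where
  semigroup : ∀ _∙_ → (∀ x y z → (x ∙ y) ∙ z ≡ x ∙ (y ∙ z)) → IsSemigroup _≡_ _∙_
  semigroup _∙_ assoc = record { isMagma = record { isEquivalence = isEquivalence ; ∙-cong = cong₂ _∙_ } ; assoc = assoc }

  ⊕-assoc : ∀ x y z → (x ⊕ y) ⊕ z ≡ x ⊕ (y ⊕ z)
  ⊕-assoc (a , b) (c , d) (e , f) = cong₂ _,_ (ℕP.+-assoc a c e) (ℕP.+-assoc b d f)

  ⊕-comm : ∀ x y → x ⊕ y ≡ y ⊕ x
  ⊕-comm (a , b) (c , d) = cong₂ _,_ (ℕP.+-comm a c) (ℕP.+-comm b d)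

  assoc₁ : ∀ a b c d e f → (a * c + b * d) * e + (a * d + b * c) * f ≡ a * (c * e + d * f) + b * (c * f + d * e)
  assoc₁ = solve-∀

  ⊗-assoc : ∀ x y z → (x ⊗ y) ⊗ z ≡ x ⊗ (y ⊗ z)
  ⊗-assoc (a , b) (c , d) (e , f) = cong₂ _,_ (assoc₁ a b c d e f) (assoc₁ a b c d f e)

  comm₁ : ∀ a b c d → a * c + b * d ≡ c * a + d * b
  comm₁ = solve-∀

  comm₂ : ∀ a b c d → a * d + b * c ≡ c * b + d * a
  comm₂ = solve-∀

  ⊗-comm : ∀ x y → x ⊗ y ≡ y ⊗ x
  ⊗-comm (a , b) (c , d) = cong₂ _,_ (comm₁ a b c d) (comm₂ a b c d)

  identity₁ : ∀ a b → 1 * a + 0 * b ≡ a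
  identity₁ = solve-∀

  ⊗-identityˡ : ∀ x → 𝟙 ⊗ x ≡ x
  ⊗-identityˡ (a , b) = cong₂ _,_ (identity₁ a b) (identity₁ b a)

  distrib₁ : ∀ a b c d e f → (a + c) * e + (b + d) * f ≡ (a * e + b * f) + (c * e + d * f)
  distrib₁ = solve-∀

  ⊗-distribʳ : ∀ z x y → (x ⊕ y) ⊗ z ≡ x ⊗ z ⊕ y ⊗ z
  ⊗-distribʳ (e , f) (a , b) (c , d) = cong₂ _,_ (distrib₁ a b c d e f) (distrib₁ a b c d f e)

module ℕ[ζ] = CommutativeSemiring ℕ[ζ]-commutativeSemiring

open import Algebra.Properties.CommutativeSemigroup ℕ[ζ].*-commutativeSemigroup using (x∙yz≈y∙xz)
open import Algebra.Solver.CommutativeMonoid ℕ[ζ].*-commutativeMonoid using (solve; _⊜_) renaming (_⊕_ to _·_)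

ζ^ : ℕ → ℕ[ζ]
ζ^ zero          = 𝟙
ζ^ (suc zero)    = ζ
ζ^ (suc (suc k)) = ζ^ k

-- the parity test in the definition of L₀ and L₁ selects ζ^k
ζ^-parity : ∀ k → (if does (k % 2 ℕ.≟ 0) then 𝟙 else ζ) ≡ ζ^ k
ζ^-parity zero          = refl
ζ^-parity (suc zero)    = refl
ζ^-parity (suc (suc k)) = ζ^-parity k

ζ^-suc : ∀ k → ζ^ (suc k) ≡ ζ ⊗ ζ^ k
ζ^-suc zero          = refl
ζ^-suc (suc zero)    = refl
ζ^-suc (suc (suc k)) = ζ^-suc k

ζ^-+ : ∀ j k → ζ^ (j + k) ≡ ζ^ j ⊗ ζ^ k
ζ^-+ zero    k = sym (ℕ[ζ].*-identityˡ (ζ^ k))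
ζ^-+ (suc j) k = begin
  ζ^ (suc (j + k))      ≡⟨ ζ^-suc (j + k) ⟩
  ζ ⊗ ζ^ (j + k)        ≡⟨ cong (ζ ⊗_) (ζ^-+ j k) ⟩
  ζ ⊗ (ζ^ j ⊗ ζ^ k)     ≡⟨ ℕ[ζ].*-assoc ζ (ζ^ j) (ζ^ k) ⟨
  ζ ⊗ ζ^ j ⊗ ζ^ k       ≡⟨ cong (_⊗ ζ^ k) (ζ^-suc j) ⟨
  ζ^ (suc j) ⊗ ζ^ k     ∎
  where open ≡-Reasoning

injective⇒surjective : ∀ {n} (f : Fin n → Fin n) → Injective _≡_ _≡_ f → ∀ y → ∃ λ x → f x ≡ y
injective⇒surjective {n} f f-inj y with FinP.any? (λ x → f x FinP.≟ y)
... | yes found = found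
injective⇒surjective {suc n} f f-inj y | no missed =
  let i , j , i<j , eq = FinP.pigeonhole (ℕP.n<1+n n) (λ x → Fin.punchOut (avoids x))
  in ⊥-elim (FinP.<⇒≢ i<j (f-inj (FinP.punchOut-injective (avoids i) (avoids j) eq)))
  where
  avoids : ∀ x → y ≢ f x
  avoids x eq = missed (x , sym eq)

module Summation {M : Set} {_+_ : M → M → M} {ε : M} (isCM : IsCommutativeMonoid _≡_ _+_ ε) where

  open IsCommutativeMonoid isCM using (assoc; identityˡ; identityʳ)

  commutativeMonoid : CommutativeMonoid 0ℓ 0ℓ
  commutativeMonoid = record { isCommutativeMonoid = isCM }

  open MonoidSum commutativeMonoid public using (sum; sum-cong-≗; ∑-comm; sum-replicate-zero; sum-permute)

  [_]·_ : ∀ {P : Set} → Dec P → M → M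
  [ d ]· x = if does d then x else ε

  [yes]· : ∀ {P : Set} (d : Dec P) → P → ∀ x → [ d ]· x ≡ x
  [yes]· (yes _) _ x = refl
  [yes]· (no ¬p) p x = ⊥-elim (¬p p)

  [no]· : ∀ {P : Set} (d : Dec P) → ¬ P → ∀ x → [ d ]· x ≡ ε
  [no]· (yes p) ¬p x = ⊥-elim (¬p p)
  [no]· (no _)  _  x = refl

  []·-cong : ∀ {P Q : Set} (d : Dec P) (e : Dec Q) → (P → Q) → (Q → P) → ∀ x → [ d ]· x ≡ [ e ]· x
  []·-cong (yes p) e f g x = sym ([yes]· e (f p) x)
  []·-cong (no ¬p) e f g x = sym ([no]· e (¬p ∘ g) x)

  []·-×-dec : ∀ {P Q : Set} (d : Dec P) (e : Dec Q) x → [ d ×-dec e ]· x ≡ [ d ]· ([ e ]· x)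
  []·-×-dec (yes _) e x = refl
  []·-×-dec (no _)  e x = refl

  sum-[]· : ∀ {n} {P : Set} (d : Dec P) (f : Fin n → M) → sum (λ a → [ d ]· f a) ≡ [ d ]· sum f
  sum-[]· (yes _) f = refl
  sum-[]· {n} (no _) f = sum-replicate-zero n

  sumList : ∀ {A : Set} → List A → (A → M) → M
  sumList []       f = ε
  sumList (x ∷ xs) f = f x + sumList xs f

  sumList-cong : ∀ {A : Set} (xs : List A) {f g : A → M} → (∀ {a} → a ∈ xs → f a ≡ g a) → sumList xs f ≡ sumList xs g
  sumList-cong []       eq = refl
  sumList-cong (x ∷ xs) eq = cong₂ _+_ (eq (here refl)) (sumList-cong xs (eq ∘ there))

  sumList-zero : ∀ {A : Set} (xs : List A) {f : A → M} → (∀ a → f a ≡ ε) → sumList xs f ≡ ε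
  sumList-zero []       f≡ε = refl
  sumList-zero (x ∷ xs) f≡ε = trans (cong₂ _+_ (f≡ε x) (sumList-zero xs f≡ε)) (identityˡ ε)

  sumList-++ : ∀ {A : Set} (xs ys : List A) f → sumList (xs ++ ys) f ≡ sumList xs f + sumList ys f
  sumList-++ []       ys f = sym (identityˡ _)
  sumList-++ (x ∷ xs) ys f = trans (cong (f x +_) (sumList-++ xs ys f)) (sym (assoc _ _ _))

  sumList-map : ∀ {A B : Set} (g : A → B) (xs : List A) f → sumList (map g xs) f ≡ sumList xs (f ∘ g)
  sumList-map g []       f = refl
  sumList-map g (x ∷ xs) f = cong (f (g x) +_) (sumList-map g xs f)

  sumList-concatMap : ∀ {A B : Set} (g : A → List B) (xs : List A) f →
                      sumList (concatMap g xs) f ≡ sumList xs (λ a → sumList (g a) f)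
  sumList-concatMap g []       f = refl
  sumList-concatMap g (x ∷ xs) f =
    trans (sumList-++ (g x) (concatMap g xs) f) (cong (sumList (g x) f +_) (sumList-concatMap g xs f))

  sumList-cartesianProduct : ∀ {A B : Set} (xs : List A) (ys : List B) f →
    sumList (cartesianProduct xs ys) f ≡ sumList xs (λ a → sumList ys (λ b → f (a , b)))
  sumList-cartesianProduct []       ys f = refl
  sumList-cartesianProduct (x ∷ xs) ys f =
    trans (sumList-++ (map (x ,_) ys) _ f)
          (cong₂ _+_ (sumList-map (x ,_) ys f) (sumList-cartesianProduct xs ys f))

  sumList-filter : ∀ {A : Set} {P : Pred A 0ℓ} (P? : Decidable P) (xs : List A) f →
                   sumList (filter P? xs) f ≡ sumList xs (λ a → [ P? a ]· f a)
  sumList-filter P? []       f = refl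
  sumList-filter P? (x ∷ xs) f with does (P? x)
  ... | true  = cong (f x +_) (sumList-filter P? xs f)
  ... | false = trans (sumList-filter P? xs f) (sym (identityˡ _))

  sumList-tabulate : ∀ {A : Set} n (g : Fin n → A) f → sumList (List.tabulate g) f ≡ sum (f ∘ g)
  sumList-tabulate zero    g f = refl
  sumList-tabulate (suc n) g f = cong (f (g zero) +_) (sumList-tabulate n (g ∘ suc) f)

  sumList-allFin : ∀ n (f : Fin n → M) → sumList (allFin n) f ≡ sum f
  sumList-allFin n = sumList-tabulate n id

  sumList-↭ : ∀ {A : Set} {xs ys : List A} f → xs ↭ ys → sumList xs f ≡ sumList ys f
  sumList-↭ {xs = xs} {ys} f p = begin
    sumList xs f                 ≡⟨ as-foldr xs ⟩
    List.foldr _+_ ε (map f xs)  ≡⟨ PermSetoid.foldr-commMonoid (setoid M) isCM (↭⇒↭ₛ′ isEquivalence (↭.map⁺ f p)) ⟩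
    List.foldr _+_ ε (map f ys)  ≡⟨ as-foldr ys ⟨
    sumList ys f                 ∎
    where
    open ≡-Reasoning
    as-foldr : ∀ zs → sumList zs f ≡ List.foldr _+_ ε (map f zs)
    as-foldr []       = refl
    as-foldr (z ∷ zs) = cong (f z +_) (as-foldr zs)

  sumList-bijection :
    ∀ {A B : Set} {xs : List A} {ys : List B}
      {SA : Pred A 0ℓ} (SA? : Decidable SA) {SB : Pred B 0ℓ} (SB? : Decidable SB)
      (wA : A → M) (wB : B → M) (g : B → A) →
    Unique xs → (∀ a → a ∈ xs) → Unique ys → (∀ b → b ∈ ys) → Injective _≡_ _≡_ g →
    (∀ {b} → SB b → SA (g b) × wA (g b) ≡ wB b) →
    (∀ {a} → SA a → ∃ λ b → SB b × g b ≡ a) →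
    sumList xs (λ a → [ SA? a ]· wA a) ≡ sumList ys (λ b → [ SB? b ]· wB b)
  sumList-bijection {xs = xs} {ys} SA? SB? wA wB g xs! xs-all ys! ys-all g-inj forth back = begin
    sumList xs (λ a → [ SA? a ]· wA a)     ≡⟨ sumList-filter SA? xs wA ⟨
    sumList (filter SA? xs) wA             ≡⟨ sumList-↭ wA supports-↭ ⟩
    sumList (map g (filter SB? ys)) wA     ≡⟨ sumList-map g (filter SB? ys) wA ⟩
    sumList (filter SB? ys) (wA ∘ g)       ≡⟨ sumList-cong (filter SB? ys) (λ b∈ → proj₂ (forth (proj₂ (∈.∈-filter⁻ SB? {xs = ys} b∈)))) ⟩
    sumList (filter SB? ys) wB             ≡⟨ sumList-filter SB? ys wB ⟩
    sumList ys (λ b → [ SB? b ]· wB b)     ∎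
    where
    open ≡-Reasoning
    to : ∀ {a} → a ∈ filter SA? xs → a ∈ map g (filter SB? ys)
    to a∈ with b , sb , refl ← back (proj₂ (∈.∈-filter⁻ SA? {xs = xs} a∈)) = ∈.∈-map⁺ g (∈.∈-filter⁺ SB? (ys-all b) sb)
    from : ∀ {a} → a ∈ map g (filter SB? ys) → a ∈ filter SA? xs
    from a∈ with b , b∈ , refl ← ∈.∈-map⁻ g a∈ =
      ∈.∈-filter⁺ SA? (xs-all (g b)) (proj₁ (forth (proj₂ (∈.∈-filter⁻ SB? {xs = ys} b∈))))
    supports-↭ : filter SA? xs ↭ map g (filter SB? ys)
    supports-↭ = ∼bag⇒↭ (unique∧set⇒bag (Unique.filter⁺ SA? xs!) (Unique.map⁺ g-inj (Unique.filter⁺ SB? ys!)) (mk⇔ to from))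

  sum-δ : ∀ {k} (j : Fin k) x → sum (λ i → [ j FinP.≟ i ]· x) ≡ x
  sum-δ {suc k} zero    x = trans (cong (x +_) (sum-replicate-zero k)) (identityʳ x)
  sum-δ {suc k} (suc j) x = trans (identityˡ _) (sum-δ j x)

  sum-reindex : ∀ {n} (f : Fin n → Fin n) → Injective _≡_ _≡_ f → ∀ h → sum (h ∘ f) ≡ sum h
  sum-reindex f f-inj h = sym (sum-permute h (permutation f f⁻¹ f∘f⁻¹ f⁻¹∘f))
    where
    f⁻¹ = λ y → proj₁ (injective⇒surjective f f-inj y)
    f∘f⁻¹ = λ y → proj₂ (injective⇒surjective f f-inj y)
    f⁻¹∘f = λ x → f-inj (f∘f⁻¹ (f x))

module Σℕ = Summation ℕP.+-0-isCommutativeMonoid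
open Summation ℕ[ζ].+-isCommutativeMonoid
open import Algebra.Properties.Semiring.Sum ℕ[ζ].semiring using (*-distribˡ-sum; *-distribʳ-sum)

⊗-[]· : ∀ {P : Set} (d : Dec P) c x → c ⊗ [ d ]· x ≡ [ d ]· (c ⊗ x)
⊗-[]· (yes _) c x = refl
⊗-[]· (no _)  c x = ℕ[ζ].zeroʳ c

[]·-⊗ : ∀ {P : Set} (d : Dec P) x y → ([ d ]· x) ⊗ y ≡ [ d ]· (x ⊗ y)
[]·-⊗ (yes _) x y = refl
[]·-⊗ (no _)  x y = ℕ[ζ].zeroˡ y

⊗-sumList : ∀ {A : Set} (xs : List A) c f → c ⊗ sumList xs f ≡ sumList xs (λ a → c ⊗ f a)
⊗-sumList []       c f = ℕ[ζ].zeroʳ c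
⊗-sumList (x ∷ xs) c f = trans (ℕ[ζ].distribˡ c (f x) _) (cong (c ⊗ f x ⊕_) (⊗-sumList xs c f))

Lζ : ∀ {n} → DecRel n → ℕ[ζ]
Lζ R = L₀ R , L₁ R

weight : ∀ {n} → DecRel n → Vec (Fin n) n → ℕ[ζ]
weight R v = [ isLinearization? R v ]· ζ^ (inversions v)

count-by-parity : ∀ {A : Set} {P E : Pred A 0ℓ} (P? : Decidable P) (E? : Decidable E) xs →
  (length (filter (λ v → P? v ×-dec E? v) xs) , length (filter (λ v → P? v ×-dec ¬? (E? v)) xs))
  ≡ sumList xs (λ v → [ P? v ]· (if does (E? v) then 𝟙 else ζ))
count-by-parity P? E? []       = refl
count-by-parity P? E? (x ∷ xs) with P? x | E? x
... | yes _ | yes _ = cong (𝟙 ⊕_) (count-by-parity P? E? xs)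
... | yes _ | no _  = cong (ζ ⊕_) (count-by-parity P? E? xs)
... | no _  | _     = count-by-parity P? E? xs

Lζ-as-sum : ∀ {n} (R : DecRel n) → Lζ R ≡ sumList (allVecs n n) (weight R)
Lζ-as-sum {n} R = trans (count-by-parity (isLinearization? R) isEven? (allVecs n n))
  (sumList-cong (allVecs n n) (λ {v} _ → cong ([ isLinearization? R v ]·_) (ζ^-parity (inversions v))))

Lζ-cong : ∀ {n} (R S : DecRel n) → (∀ {a b} → rel R a b → rel S a b) → (∀ {a b} → rel S a b → rel R a b) →
          Lζ R ≡ Lζ S
Lζ-cong {n} R S R⇒S S⇒R = begin
  Lζ R                             ≡⟨ Lζ-as-sum R ⟩
  sumList (allVecs n n) (weight R) ≡⟨ sumList-cong (allVecs n n) (λ {v} _ → []·-cong (isLinearization? R v) (isLinearization? S v)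
                                        (map₂ (λ ord p q → ord p q ∘ S⇒R)) (map₂ (λ ord p q → ord p q ∘ R⇒S)) _) ⟩
  sumList (allVecs n n) (weight S) ≡⟨ Lζ-as-sum S ⟨
  Lζ S                             ∎
  where open ≡-Reasoning

allVecs-unique : ∀ n k → Unique (allVecs n k)
allVecs-unique zero    k = All.[] AllPairs.∷ AllPairs.[]
allVecs-unique (suc n) k =
  Unique.concat⁺ (All.map⁺ (All.universal (λ x → Unique.map⁺ VecP.∷-injectiveʳ (allVecs-unique n k)) (allFin k)))
                 (AllPairs.map⁺ (AllPairs.map disjoint (Unique.allFin⁺ k)))
  where
  disjoint : ∀ {x y} → x ≢ y → Disjoint (map (x ∷_) (allVecs n k)) (map (y ∷_) (allVecs n k))
  disjoint x≢y (v∈x , v∈y) with _ , _ , refl ← ∈.∈-map⁻ _ v∈x | _ , _ , eq ← ∈.∈-map⁻ _ v∈y =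
    x≢y (VecP.∷-injectiveˡ eq)

allVecs-complete : ∀ n k (v : Vec (Fin k) n) → v ∈ allVecs n k
allVecs-complete zero    k []      = here refl
allVecs-complete (suc n) k (x ∷ v) =
  ∈.∈-concatMap⁺ (λ y → map (y ∷_) (allVecs n k)) (lose (∈.∈-allFin x) (∈.∈-map⁺ (x ∷_) (allVecs-complete n k v)))

inverted? : ∀ {n} (v : Vec (Fin n) n) (p q : Fin n) → Dec (p Fin.< q × lookup v q Fin.< lookup v p)
inverted? v p q = (p Fin.<? q) ×-dec (lookup v q Fin.<? lookup v p)

length-filter : ∀ {A : Set} {P : Pred A 0ℓ} (P? : Decidable P) xs →
                length (filter P? xs) ≡ Σℕ.sumList xs (λ a → Σℕ.[ P? a ]· 1)
length-filter P? []       = refl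
length-filter P? (x ∷ xs) with does (P? x)
... | true  = cong suc (length-filter P? xs)
... | false = length-filter P? xs

inversions-as-sum : ∀ {n} (v : Vec (Fin n) n) →
  inversions v ≡ Σℕ.sum (λ (p : Fin n) → Σℕ.sum (λ (q : Fin n) → Σℕ.[ inverted? v p q ]· 1))
inversions-as-sum {n} v = begin
  inversions v
    ≡⟨ length-filter (λ pq → inverted? v (proj₁ pq) (proj₂ pq)) (cartesianProduct (allFin n) (allFin n)) ⟩
  Σℕ.sumList (cartesianProduct (allFin n) (allFin n)) (λ pq → Σℕ.[ inverted? v (proj₁ pq) (proj₂ pq) ]· 1)
    ≡⟨ Σℕ.sumList-cartesianProduct (allFin n) (allFin n) _ ⟩
  Σℕ.sumList (allFin n) (λ p → Σℕ.sumList (allFin n) (λ q → Σℕ.[ inverted? v p q ]· 1))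
    ≡⟨ Σℕ.sumList-allFin n _ ⟩
  Σℕ.sum (λ (p : Fin n) → Σℕ.sumList (allFin n) (λ q → Σℕ.[ inverted? v p q ]· 1))
    ≡⟨ Σℕ.sum-cong-≗ {n} (λ p → Σℕ.sumList-allFin n _) ⟩
  Σℕ.sum (λ (p : Fin n) → Σℕ.sum (λ (q : Fin n) → Σℕ.[ inverted? v p q ]· 1))
    ∎
  where open ≡-Reasoning

count-below : ∀ n t → t ℕ.≤ n → Σℕ.sum (λ (a : Fin n) → Σℕ.[ toℕ a ℕ.<? t ]· 1) ≡ t
count-below n       zero    _         =
  trans (Σℕ.sum-cong-≗ {n} (λ a → Σℕ.[no]· (toℕ a ℕ.<? 0) (λ ()) 1)) (Σℕ.sum-replicate-zero n)
count-below (suc n) (suc t) (s≤s t≤n) = cong suc (begin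
  Σℕ.sum (λ (a : Fin n) → Σℕ.[ toℕ (suc a) ℕ.<? suc t ]· 1) ≡⟨ Σℕ.sum-cong-≗ {n} (λ a → Σℕ.[]·-cong (toℕ (suc a) ℕ.<? suc t) (toℕ a ℕ.<? t) ℕ.s≤s⁻¹ s≤s 1) ⟩
  Σℕ.sum (λ (a : Fin n) → Σℕ.[ toℕ a ℕ.<? t ]· 1) ≡⟨ count-below n t t≤n ⟩
  t                                               ∎)
  where open ≡-Reasoning

toℕ-punchIn-< : ∀ {n} (x : Fin (suc n)) (a : Fin n) → toℕ a ℕ.< toℕ x → toℕ (punchIn x a) ≡ toℕ a
toℕ-punchIn-< (suc x) zero    _         = refl
toℕ-punchIn-< (suc x) (suc a) (s≤s a<x) = cong suc (toℕ-punchIn-< x a a<x)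

toℕ-punchIn-≥ : ∀ {n} (x : Fin (suc n)) (a : Fin n) → toℕ x ℕ.≤ toℕ a → toℕ (punchIn x a) ≡ suc (toℕ a)
toℕ-punchIn-≥ zero    a       _         = refl
toℕ-punchIn-≥ (suc x) (suc a) (s≤s x≤a) = cong suc (toℕ-punchIn-≥ x a x≤a)

punchIn-below⁺ : ∀ {n} (x : Fin (suc n)) (a : Fin n) → toℕ a ℕ.< toℕ x → toℕ (punchIn x a) ℕ.< toℕ x
punchIn-below⁺ x a a<x = subst (ℕ._< toℕ x) (sym (toℕ-punchIn-< x a a<x)) a<x

punchIn-below⁻ : ∀ {n} (x : Fin (suc n)) (a : Fin n) → toℕ (punchIn x a) ℕ.< toℕ x → toℕ a ℕ.< toℕ x
punchIn-below⁻ x a p<x with toℕ a ℕ.<? toℕ x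
... | yes a<x = a<x
... | no  a≮x = ⊥-elim (ℕP.<-asym p<x (subst (toℕ x ℕ.<_) (sym (toℕ-punchIn-≥ x a x≤a)) (s≤s x≤a)))
  where x≤a = ℕP.≮⇒≥ a≮x

punchIn-mono-< : ∀ {n} (x : Fin (suc n)) (a b : Fin n) → a Fin.< b → punchIn x a Fin.< punchIn x b
punchIn-mono-< x a b a<b = ℕP.≰⇒> (ℕP.<⇒≱ a<b ∘ FinP.punchIn-cancel-≤ x b a)

punchIn-cancel-< : ∀ {n} (x : Fin (suc n)) (a b : Fin n) → punchIn x a Fin.< punchIn x b → a Fin.< b
punchIn-cancel-< x a b a<b = ℕP.≰⇒> (ℕP.<⇒≱ a<b ∘ FinP.punchIn-mono-≤ x b a)

-- Putting x in front of a listing w of the remaining elements creates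
-- one new inversion for each element below x.
inversions-cons : ∀ {n} (x : Fin (suc n)) (w : Vec (Fin n) n) → Injective _≡_ _≡_ (lookup w) →
                  inversions (x ∷ Vec.map (punchIn x) w) ≡ toℕ x + inversions w
inversions-cons {n} x w w-inj = begin
  inversions v
    ≡⟨ inversions-as-sum v ⟩
  (Σℕ.[ inverted? v zero zero ]· 1 + Σℕ.sum (λ (q : Fin n) → Σℕ.[ inverted? v zero (suc q) ]· 1))
    + Σℕ.sum (λ (p : Fin n) → Σℕ.[ inverted? v (suc p) zero ]· 1 + Σℕ.sum (λ (q : Fin n) → Σℕ.[ inverted? v (suc p) (suc q) ]· 1))
    ≡⟨ cong₂ _+_ (cong₂ _+_ (Σℕ.[no]· (inverted? v zero zero) (λ ()) 1) new) (Σℕ.sum-cong-≗ {n} old) ⟩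
  toℕ x + Σℕ.sum (λ (p : Fin n) → Σℕ.sum (λ (q : Fin n) → Σℕ.[ inverted? w p q ]· 1))
    ≡⟨ cong (toℕ x +_) (inversions-as-sum w) ⟨
  toℕ x + inversions w
    ∎
  where
  open ≡-Reasoning
  v = x ∷ Vec.map (punchIn x) w
  v[_] : ∀ q → lookup v (suc q) ≡ punchIn x (lookup w q)
  v[ q ] = VecP.lookup-map q (punchIn x) w
  -- the pairs (0 , q) that are inversions are those with w q below x
  new : Σℕ.sum (λ (q : Fin n) → Σℕ.[ inverted? v zero (suc q) ]· 1) ≡ toℕ x
  new = begin
    Σℕ.sum (λ (q : Fin n) → Σℕ.[ inverted? v zero (suc q) ]· 1)
      ≡⟨ Σℕ.sum-cong-≗ {n} (λ q → Σℕ.[]·-cong (inverted? v zero (suc q)) (toℕ (lookup w q) ℕ.<? toℕ x)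
           (λ (_ , v<x) → punchIn-below⁻ x (lookup w q) (subst (λ y → toℕ y ℕ.< toℕ x) v[ q ] v<x))
           (λ w<x → s≤s z≤n , subst (λ y → toℕ y ℕ.< toℕ x) (sym v[ q ]) (punchIn-below⁺ x (lookup w q) w<x)) 1) ⟩
    Σℕ.sum (λ (q : Fin n) → Σℕ.[ toℕ (lookup w q) ℕ.<? toℕ x ]· 1)
      ≡⟨ Σℕ.sum-reindex (lookup w) w-inj (λ a → Σℕ.[ toℕ a ℕ.<? toℕ x ]· 1) ⟩
    Σℕ.sum (λ (a : Fin n) → Σℕ.[ toℕ a ℕ.<? toℕ x ]· 1)
      ≡⟨ count-below n (toℕ x) (FinP.toℕ≤pred[n] x) ⟩
    toℕ x
      ∎
  old : ∀ p → Σℕ.[ inverted? v (suc p) zero ]· 1 + Σℕ.sum (λ (q : Fin n) → Σℕ.[ inverted? v (suc p) (suc q) ]· 1)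
            ≡ Σℕ.sum (λ (q : Fin n) → Σℕ.[ inverted? w p q ]· 1)
  old p = cong₂ _+_ (Σℕ.[no]· (inverted? v (suc p) zero) (λ ()) 1) (Σℕ.sum-cong-≗ {n} (λ q →
    Σℕ.[]·-cong (inverted? v (suc p) (suc q)) (inverted? w p q)
      (λ (p<q , vq<vp) → ℕ.s≤s⁻¹ p<q , punchIn-cancel-< x (lookup w q) (lookup w p) (subst₂ Fin._<_ v[ q ] v[ p ] vq<vp))
      (λ (p<q , wq<wp) → s≤s p<q , subst₂ Fin._<_ (sym v[ q ]) (sym v[ p ]) (punchIn-mono-< x (lookup w q) (lookup w p) wq<wp)) 1))

pullback : ∀ {m n} → DecRel n → (Fin m → Fin n) → DecRel m
pullback R e = record { rel = λ a b → rel R (e a) (e b) ; rel? = λ a b → DecRel.rel? R (e a) (e b) }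

Lζ-pullback-≗ : ∀ {m n} (R : DecRel n) {e e' : Fin m → Fin n} → (∀ a → e a ≡ e' a) →
                Lζ (pullback R e) ≡ Lζ (pullback R e')
Lζ-pullback-≗ R e≗e' = Lζ-cong (pullback R _) (pullback R _)
  (λ {a} {b} → subst₂ (rel R) (e≗e' a) (e≗e' b)) (λ {a} {b} → subst₂ (rel R) (sym (e≗e' a)) (sym (e≗e' b)))

skip : ∀ {m} → Fin m → Fin (ℕ.pred m) → Fin m
skip {suc m} a = punchIn a

_∖_ : ∀ {m} → DecRel m → Fin m → DecRel (ℕ.pred m)
R ∖ x = pullback R (skip x)

Minimal : ∀ {n} → DecRel n → Fin n → Set
Minimal R x = ∀ y → y ≢ x → ¬ rel R y x

minimal? : ∀ {n} (R : DecRel n) x → Dec (Minimal R x)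
minimal? R x = FinP.all? (λ y → ¬? (y FinP.≟ x) →-dec ¬? (DecRel.rel? R y x))

head-minimal : ∀ {n} (R : DecRel (suc n)) x (v : Vec (Fin (suc n)) n) → IsLinearization R (x ∷ v) → Minimal R x
head-minimal R x v (inj , ord) y y≢x yRx with injective⇒surjective (lookup (x ∷ v)) (inj _ _) y
... | zero  , refl = y≢x refl
... | suc q , refl with () ← ord (suc q) zero yRx

map-injective : ∀ {A B : Set} {n} (f : A → B) → Injective _≡_ _≡_ f → Injective _≡_ _≡_ (Vec.map {n = n} f)
map-injective f f-inj {[]}    {[]}      _  = refl
map-injective f f-inj {a ∷ u} {b ∷ u'} eq =
  cong₂ _∷_ (f-inj (VecP.∷-injectiveˡ eq)) (map-injective f f-inj (VecP.∷-injectiveʳ eq))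

module _ {n} (R : DecRel (suc n)) (x : Fin (suc n)) where

  extend-linearization : Minimal R x → ∀ w → IsLinearization (R ∖ x) w → IsLinearization R (x ∷ Vec.map (punchIn x) w)
  extend-linearization x-min w (w-inj , w-ord) = inj , ord
    where
    v[_] : ∀ q → lookup (Vec.map (punchIn x) w) q ≡ punchIn x (lookup w q)
    v[ q ] = VecP.lookup-map q (punchIn x) w
    inj : ∀ p q → lookup (x ∷ Vec.map (punchIn x) w) p ≡ lookup (x ∷ Vec.map (punchIn x) w) q → p ≡ q
    inj zero    zero    eq = refl
    inj zero    (suc q) eq = ⊥-elim (FinP.punchInᵢ≢i x (lookup w q) (sym (trans eq v[ q ])))
    inj (suc p) zero    eq = ⊥-elim (FinP.punchInᵢ≢i x (lookup w p) (trans (sym v[ p ]) eq))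
    inj (suc p) (suc q) eq = cong suc (w-inj p q (FinP.punchIn-injective x _ _ (trans (sym v[ p ]) (trans eq v[ q ]))))
    ord : ∀ p q → rel R (lookup (x ∷ Vec.map (punchIn x) w) p) (lookup (x ∷ Vec.map (punchIn x) w) q) → p Fin.≤ q
    ord zero    q       _ = z≤n
    ord (suc p) zero    r = ⊥-elim (x-min _ (λ eq → FinP.punchInᵢ≢i x (lookup w p) (trans (sym v[ p ]) eq)) r)
    ord (suc p) (suc q) r = s≤s (w-ord p q (subst₂ (rel R) v[ p ] v[ q ] r))

  restrict-linearization : ∀ v → IsLinearization R (x ∷ v) →
                           ∃ λ w → IsLinearization (R ∖ x) w × Vec.map (punchIn x) w ≡ v
  restrict-linearization v (inj , ord) = w , (w-inj , w-ord) , map-w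
    where
    x≢v[_] : ∀ q → x ≢ lookup v q
    x≢v[ q ] eq with () ← inj zero (suc q) eq
    w = Vec.tabulate (λ q → punchOut x≢v[ q ])
    w[_] : ∀ q → punchIn x (lookup w q) ≡ lookup v q
    w[ q ] = trans (cong (punchIn x) (VecP.lookup∘tabulate _ q)) (FinP.punchIn-punchOut x≢v[ q ])
    map-w : Vec.map (punchIn x) w ≡ v
    map-w = begin
      Vec.map (punchIn x) w                         ≡⟨ cong (Vec.map (punchIn x)) (VecP.tabulate∘lookup w) ⟨
      Vec.map (punchIn x) (Vec.tabulate (lookup w)) ≡⟨ VecP.tabulate-∘ (punchIn x) (lookup w) ⟨
      Vec.tabulate (punchIn x ∘ lookup w)           ≡⟨ VecP.tabulate-cong w[_] ⟩
      Vec.tabulate (lookup v)                       ≡⟨ VecP.tabulate∘lookup v ⟩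
      v                                             ∎
      where open ≡-Reasoning
    w-inj : ∀ p q → lookup w p ≡ lookup w q → p ≡ q
    w-inj p q eq = FinP.suc-injective (inj (suc p) (suc q) (trans (sym w[ p ]) (trans (cong (punchIn x) eq) w[ q ])))
    w-ord : ∀ p q → rel (R ∖ x) (lookup w p) (lookup w q) → p Fin.≤ q
    w-ord p q r = ℕ.s≤s⁻¹ (ord (suc p) (suc q) (subst₂ (rel R) w[ p ] w[ q ] r))

  linearizations-starting-with :
    sumList (allVecs n (suc n)) (λ v → weight R (x ∷ v)) ≡ [ minimal? R x ]· (ζ^ (toℕ x) ⊗ Lζ (R ∖ x))
  linearizations-starting-with = by-cases (minimal? R x)
    where
    by-cases : (d : Dec (Minimal R x)) →
      sumList (allVecs n (suc n)) (λ v → weight R (x ∷ v)) ≡ [ d ]· (ζ^ (toℕ x) ⊗ Lζ (R ∖ x))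
    by-cases (no ¬min) = sumList-zero (allVecs n (suc n)) (λ v → [no]· (isLinearization? R (x ∷ v)) (¬min ∘ head-minimal R x v) _)
    by-cases (yes min) = begin
      sumList (allVecs n (suc n)) (λ v → weight R (x ∷ v))
        ≡⟨ sumList-bijection (λ v → isLinearization? R (x ∷ v)) (isLinearization? (R ∖ x))
             (λ v → ζ^ (inversions (x ∷ v))) (λ w → ζ^ (toℕ x) ⊗ ζ^ (inversions w)) (Vec.map (punchIn x))
             (allVecs-unique n (suc n)) (allVecs-complete n (suc n)) (allVecs-unique n n) (allVecs-complete n n)
             (map-injective (punchIn x) (FinP.punchIn-injective x _ _))
             (λ {w} w-lin → extend-linearization min w w-lin , weight-cons w w-lin)
             (λ {v} → restrict-linearization v) ⟩
      sumList (allVecs n n) (λ w → [ isLinearization? (R ∖ x) w ]· (ζ^ (toℕ x) ⊗ ζ^ (inversions w)))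
        ≡⟨ sumList-cong (allVecs n n) (λ {w} _ → ⊗-[]· (isLinearization? (R ∖ x) w) (ζ^ (toℕ x)) _) ⟨
      sumList (allVecs n n) (λ w → ζ^ (toℕ x) ⊗ weight (R ∖ x) w)
        ≡⟨ ⊗-sumList (allVecs n n) (ζ^ (toℕ x)) (weight (R ∖ x)) ⟨
      ζ^ (toℕ x) ⊗ sumList (allVecs n n) (weight (R ∖ x))
        ≡⟨ cong (ζ^ (toℕ x) ⊗_) (Lζ-as-sum (R ∖ x)) ⟨
      ζ^ (toℕ x) ⊗ Lζ (R ∖ x)
        ∎
      where
      open ≡-Reasoning
      weight-cons : ∀ w → IsLinearization (R ∖ x) w → ζ^ (inversions (x ∷ Vec.map (punchIn x) w)) ≡ ζ^ (toℕ x) ⊗ ζ^ (inversions w)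
      weight-cons w (w-inj , _) = trans (cong ζ^ (inversions-cons x w (w-inj _ _))) (ζ^-+ (toℕ x) (inversions w))

L-first-element : ∀ {n} (R : DecRel (suc n)) → Lζ R ≡ sum (λ x → [ minimal? R x ]· (ζ^ (toℕ x) ⊗ Lζ (R ∖ x)))
L-first-element {n} R = begin
  Lζ R
    ≡⟨ Lζ-as-sum R ⟩
  sumList (concatMap (λ x → map (x ∷_) (allVecs n (suc n))) (allFin (suc n))) (weight R)
    ≡⟨ sumList-concatMap (λ x → map (x ∷_) (allVecs n (suc n))) (allFin (suc n)) (weight R) ⟩
  sumList (allFin (suc n)) (λ x → sumList (map (x ∷_) (allVecs n (suc n))) (weight R))
    ≡⟨ sumList-allFin (suc n) _ ⟩
  sum (λ x → sumList (map (x ∷_) (allVecs n (suc n))) (weight R))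
    ≡⟨ sum-cong-≗ {suc n} (λ x → trans (sumList-map (x ∷_) (allVecs n (suc n)) (weight R)) (linearizations-starting-with R x)) ⟩
  sum (λ x → [ minimal? R x ]· (ζ^ (toℕ x) ⊗ Lζ (R ∖ x)))
    ∎
  where open ≡-Reasoning

module Πζ = MonoidSum ℕ[ζ].*-commutativeMonoid

∏ : ∀ {k} → (Fin k → ℕ[ζ]) → ℕ[ζ]
∏ = Πζ.sum

_[_≔_] : ∀ {A : Set} {k} → (Fin k → A) → Fin k → A → Fin k → A
(f [ i ≔ X ]) i' = if does (i' FinP.≟ i) then X else f i'

∏-update : ∀ {k} (f : Fin k → ℕ[ζ]) i X → ∏ (f [ i ≔ X ]) ≡ X ⊗ ∏ (f [ i ≔ 𝟙 ])
∏-update f zero    X = cong (X ⊗_) (sym (ℕ[ζ].*-identityˡ _))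
∏-update f (suc j) X = begin
  f zero ⊗ ∏ ((f ∘ suc) [ j ≔ X ])        ≡⟨ cong (f zero ⊗_) (∏-update (f ∘ suc) j X) ⟩
  f zero ⊗ (X ⊗ ∏ ((f ∘ suc) [ j ≔ 𝟙 ]))  ≡⟨ x∙yz≈y∙xz (f zero) X _ ⟩
  X ⊗ (f zero ⊗ ∏ ((f ∘ suc) [ j ≔ 𝟙 ]))  ∎
  where open ≡-Reasoning

∏-extract : ∀ {k} (f : Fin k → ℕ[ζ]) i → ∏ f ≡ f i ⊗ ∏ (f [ i ≔ 𝟙 ])
∏-extract f i = trans (Πζ.sum-cong-≗ unchanged) (∏-update f i (f i))
  where
  unchanged : ∀ i' → f i' ≡ (f [ i ≔ f i ]) i'
  unchanged i' with i' FinP.≟ i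
  ... | yes refl = refl
  ... | no _     = refl

-- Fin n cut into k consecutive, possibly empty, intervals: block i has
-- size i elements, its a-th element embed i a sits at position offset i + a.
record Blocks (n k : ℕ) : Set where
  field
    size        : Fin k → ℕ
    offset      : Fin k → ℕ
    block       : Fin n → Fin k
    embed       : (i : Fin k) → Fin (size i) → Fin n
    block-embed : ∀ i a → block (embed i a) ≡ i
    toℕ-embed   : ∀ i a → toℕ (embed i a) ≡ offset i + toℕ a
    embed-onto  : ∀ x → ∃ λ a → embed (block x) a ≡ x
    block-mono  : ∀ x y → toℕ x ℕ.≤ toℕ y → toℕ (block x) ℕ.≤ toℕ (block y)

module BlockFacts {n k} (B : Blocks n k) where
  open Blocks B

  embed-injective : ∀ i → Injective _≡_ _≡_ (embed i)
  embed-injective i {a} {b} eq = FinP.toℕ-injective (ℕP.+-cancelˡ-≡ (offset i) _ _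
    (trans (sym (toℕ-embed i a)) (trans (cong toℕ eq) (toℕ-embed i b))))

  embed-onto′ : ∀ i x → block x ≡ i → ∃ λ a → embed i a ≡ x
  embed-onto′ _ x refl = embed-onto x

  block-convex : ∀ u w v → toℕ u ℕ.≤ toℕ w → toℕ w ℕ.≤ toℕ v → block u ≡ block v → block w ≡ block u
  block-convex u w v u≤w w≤v eq = FinP.toℕ-injective (ℕP.≤-antisym
    (subst (λ z → toℕ (block w) ℕ.≤ toℕ z) (sym eq) (block-mono w v w≤v)) (block-mono u w u≤w))

  block-<⇒< : ∀ x y {i j} → block x ≡ i → block y ≡ j → toℕ i ℕ.< toℕ j → toℕ x ℕ.< toℕ y
  block-<⇒< x y refl refl bx<by = ℕP.≰⇒> (ℕP.<⇒≱ bx<by ∘ block-mono y x)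

  embed-mono-< : ∀ i (c c' : Fin (size i)) → toℕ c ℕ.< toℕ c' → toℕ (embed i c) ℕ.< toℕ (embed i c')
  embed-mono-< i c c' c<c' = subst₂ ℕ._<_ (sym (toℕ-embed i c)) (sym (toℕ-embed i c')) (ℕP.+-monoʳ-< (offset i) c<c')

AgreesBetween : ∀ {n k} → Blocks n k → DecRel k → DecRel n → Set
AgreesBetween B Q R = ∀ x y → block x ≢ block y → rel R x y ⇔ rel Q (block x) (block y)
  where open Blocks B

ChainWithin : ∀ {n k} → Blocks n k → DecRel n → Set
ChainWithin B R = ∀ x y → block x ≡ block y → rel R x y ⇔ toℕ x ℕ.≤ toℕ y
  where open Blocks B

restrict : ∀ {n k} (B : Blocks n k) → DecRel n → (i : Fin k) → DecRel (Blocks.size B i)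
restrict B R i = pullback R (Blocks.embed B i)

toℕ-punchOut-< : ∀ {n} {x z : Fin (suc n)} (x≢z : x ≢ z) → toℕ z ℕ.< toℕ x → toℕ (punchOut x≢z) ≡ toℕ z
toℕ-punchOut-< {suc n} {suc x} {zero}  x≢z _         = refl
toℕ-punchOut-< {suc n} {suc x} {suc z} x≢z (s≤s z<x) = cong suc (toℕ-punchOut-< (x≢z ∘ cong suc) z<x)

toℕ-punchOut-> : ∀ {n} {x z : Fin (suc n)} (x≢z : x ≢ z) → toℕ x ℕ.< toℕ z → suc (toℕ (punchOut x≢z)) ≡ toℕ z
toℕ-punchOut-> {n}     {zero}  {suc z} x≢z _         = refl
toℕ-punchOut-> {suc n} {suc x} {suc z} x≢z (s≤s x<z) = cong suc (toℕ-punchOut-> (x≢z ∘ cong suc) x<z)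

least : ∀ {m} → Fin m → Fin m
least {suc m} _ = zero

toℕ-least : ∀ {m} (a : Fin m) → toℕ (least a) ≡ 0
toℕ-least {suc m} _ = refl

skip-≢ : ∀ {m} (a : Fin m) b → skip a b ≢ a
skip-≢ {suc m} = FinP.punchInᵢ≢i

unskip : ∀ {m} (a b : Fin m) → a ≢ b → Fin (ℕ.pred m)
unskip {suc m} a b a≢b = punchOut a≢b

skip-unskip : ∀ {m} (a b : Fin m) (a≢b : a ≢ b) → skip a (unskip a b a≢b) ≡ b
skip-unskip {suc m} a b = FinP.punchIn-punchOut

toℕ-skip-< : ∀ {m} (a : Fin m) b → toℕ b ℕ.< toℕ a → toℕ (skip a b) ≡ toℕ b
toℕ-skip-< {suc m} = toℕ-punchIn-<

toℕ-skip-≥ : ∀ {m} (a : Fin m) b → toℕ a ℕ.≤ toℕ b → toℕ (skip a b) ≡ suc (toℕ b)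
toℕ-skip-≥ {suc m} = toℕ-punchIn-≥

-- Deleting x = embed i a from a block decomposition.  The remaining
-- elements keep their blocks: block i loses its element a, and the
-- blocks after block i move down by one position.
module Deletion {n k} (B : Blocks (suc n) k) (i : Fin k) (a : Fin (Blocks.size B i)) where
  open Blocks B
  open BlockFacts B

  x : Fin (suc n)
  x = embed i a

  size′ : (i' : Fin k) → Dec (i' ≡ i) → ℕ
  size′ i' (yes _) = ℕ.pred (size i)
  size′ i' (no _)  = size i'

  old : ∀ i' d → Fin (size′ i' d) → Fin (size i')
  old i' (yes refl) b = skip a b
  old i' (no _)     b = b

  x≢old : ∀ i' d b → x ≢ embed i' (old i' d b)
  x≢old i' (yes refl) b eq = skip-≢ a b (sym (embed-injective i eq))
  x≢old i' (no i'≢i)  b eq = i'≢i (trans (sym (block-embed i' b)) (trans (cong block (sym eq)) (block-embed i a)))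

  embed′ : ∀ i' d → Fin (size′ i' d) → Fin n
  embed′ i' d b = punchOut (x≢old i' d b)

  punchIn-embed′ : ∀ i' d b → punchIn x (embed′ i' d b) ≡ embed i' (old i' d b)
  punchIn-embed′ i' d b = FinP.punchIn-punchOut (x≢old i' d b)

  offset′ : (i' : Fin k) → Dec (i' Fin.≤ i) → ℕ
  offset′ i' (yes _) = offset i'
  offset′ i' (no _)  = ℕ.pred (offset i')

  toℕ-embed′-before : ∀ i' (i'≢i : i' ≢ i) → toℕ i' ℕ.< toℕ i → ∀ b → toℕ (embed′ i' (no i'≢i) b) ≡ offset i' + toℕ b
  toℕ-embed′-before i' i'≢i i'<i b =
    trans (toℕ-punchOut-< (x≢old i' (no i'≢i) b) (block-<⇒< (embed i' b) x (block-embed i' b) (block-embed i a) i'<i))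
          (toℕ-embed i' b)

  toℕ-embed′-after : ∀ i' (i'≢i : i' ≢ i) → toℕ i ℕ.< toℕ i' → ∀ b → toℕ (embed′ i' (no i'≢i) b) ≡ ℕ.pred (offset i') + toℕ b
  toℕ-embed′-after i' i'≢i i<i' b = ℕP.suc-injective (begin
    suc (toℕ (embed′ i' (no i'≢i) b)) ≡⟨ toℕ-punchOut-> (x≢old i' (no i'≢i) b) (x-before (embed i' b) (block-embed i' b)) ⟩
    toℕ (embed i' b)                  ≡⟨ toℕ-embed i' b ⟩
    offset i' + toℕ b                 ≡⟨ cong (_+ toℕ b) (ℕP.suc-pred (offset i') ⦃ ℕ.>-nonZero offset>0 ⦄) ⟨
    suc (ℕ.pred (offset i')) + toℕ b  ∎)
    where
    open ≡-Reasoning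
    x-before : ∀ z → block z ≡ i' → toℕ x ℕ.< toℕ z
    x-before z bz = block-<⇒< x z (block-embed i a) bz i<i'
    -- the first element of block i', at position offset i', lies after x
    offset>0 : 0 ℕ.< offset i'
    offset>0 = ℕP.≤-<-trans z≤n (subst (toℕ x ℕ.<_) first-position (x-before (embed i' (least b)) (block-embed i' (least b))))
      where
      first-position : toℕ (embed i' (least b)) ≡ offset i'
      first-position = trans (toℕ-embed i' (least b)) (trans (cong (offset i' +_) (toℕ-least b)) (ℕP.+-identityʳ _))

  toℕ-embed′-at : ∀ b → toℕ (embed′ i (yes refl) b) ≡ offset i + toℕ b
  toℕ-embed′-at b with toℕ b ℕ.<? toℕ a
  ... | yes b<a = begin
    toℕ (embed′ i (yes refl) b)   ≡⟨ toℕ-punchOut-< (x≢old i (yes refl) b) (embed-mono-< i (skip a b) a skip<a) ⟩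
    toℕ (embed i (skip a b))      ≡⟨ toℕ-embed i (skip a b) ⟩
    offset i + toℕ (skip a b)     ≡⟨ cong (offset i +_) (toℕ-skip-< a b b<a) ⟩
    offset i + toℕ b              ∎
    where
    open ≡-Reasoning
    skip<a = subst (ℕ._< toℕ a) (sym (toℕ-skip-< a b b<a)) b<a
  ... | no b≮a = ℕP.suc-injective (begin
    suc (toℕ (embed′ i (yes refl) b)) ≡⟨ toℕ-punchOut-> (x≢old i (yes refl) b) (embed-mono-< i a (skip a b) a<skip) ⟩
    toℕ (embed i (skip a b))          ≡⟨ toℕ-embed i (skip a b) ⟩
    offset i + toℕ (skip a b)         ≡⟨ cong (offset i +_) (toℕ-skip-≥ a b a≤b) ⟩
    offset i + suc (toℕ b)            ≡⟨ ℕP.+-suc (offset i) (toℕ b) ⟩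
    suc (offset i + toℕ b)            ∎)
    where
    open ≡-Reasoning
    a≤b = ℕP.≮⇒≥ b≮a
    a<skip = subst (toℕ a ℕ.<_) (sym (toℕ-skip-≥ a b a≤b)) (s≤s a≤b)

  toℕ-embed′ : ∀ i' (d : Dec (i' ≡ i)) (e : Dec (i' Fin.≤ i)) b → toℕ (embed′ i' d b) ≡ offset′ i' e + toℕ b
  toℕ-embed′ i' (yes refl) (yes _)   b = toℕ-embed′-at b
  toℕ-embed′ i' (yes refl) (no i≰i)  b = ⊥-elim (i≰i ℕP.≤-refl)
  toℕ-embed′ i' (no i'≢i)  (yes i'≤i) b = toℕ-embed′-before i' i'≢i (ℕP.≤∧≢⇒< i'≤i (i'≢i ∘ FinP.toℕ-injective)) b
  toℕ-embed′ i' (no i'≢i)  (no i'≰i) b = toℕ-embed′-after i' i'≢i (ℕP.≰⇒> i'≰i) b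

  embed′-onto : ∀ y i' (d : Dec (i' ≡ i)) (c : Fin (size i')) → embed i' c ≡ punchIn x y → ∃ λ b → embed′ i' d b ≡ y
  embed′-onto y i' (yes refl) c eq = unskip a c a≢c ,
    trans (FinP.punchOut-cong x (trans (cong (embed i) (skip-unskip a c a≢c)) eq)) (FinP.punchOut-punchIn x)
    where
    a≢c : a ≢ c
    a≢c a≡c = FinP.punchInᵢ≢i x y (sym (trans (cong (embed i) a≡c) eq))
  embed′-onto y i' (no _) c eq = c , trans (FinP.punchOut-cong x eq) (FinP.punchOut-punchIn x)

  blocks : Blocks n k
  blocks = record
    { size        = λ i' → size′ i' (i' FinP.≟ i)
    ; offset      = λ i' → offset′ i' (i' Fin.≤? i)
    ; block       = λ y → block (punchIn x y)
    ; embed       = λ i' → embed′ i' (i' FinP.≟ i)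
    ; block-embed = λ i' b → trans (cong block (punchIn-embed′ i' (i' FinP.≟ i) b)) (block-embed i' _)
    ; toℕ-embed   = λ i' → toℕ-embed′ i' (i' FinP.≟ i) (i' Fin.≤? i)
    ; embed-onto  = λ y → let c , eq = embed-onto (punchIn x y) in embed′-onto y _ (block (punchIn x y) FinP.≟ i) c eq
    ; block-mono  = λ y y' y≤y' → block-mono (punchIn x y) (punchIn x y') (FinP.punchIn-mono-≤ x y y' y≤y')
    }

  L-restrict-deletion : ∀ (R : DecRel (suc n)) i' →
    Lζ (restrict blocks (R ∖ x) i') ≡ ((Lζ ∘ restrict B R) [ i ≔ Lζ (restrict B R i ∖ a) ]) i'
  L-restrict-deletion R i' = by-cases (i' FinP.≟ i)
    where
    by-cases : (d : Dec (i' ≡ i)) →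
      Lζ (pullback (R ∖ x) (embed′ i' d)) ≡ (if does d then Lζ (restrict B R i ∖ a) else Lζ (restrict B R i'))
    by-cases (yes refl) = Lζ-pullback-≗ R (punchIn-embed′ i' (yes refl))
    by-cases (no i'≢i)  = Lζ-pullback-≗ R (punchIn-embed′ i' (no i'≢i))

sum-by-blocks : ∀ {n k} (B : Blocks n k) (H : Fin n → ℕ[ζ]) → sum H ≡ sum (λ i → sum (H ∘ Blocks.embed B i))
sum-by-blocks {n} {k} B H = begin
  sum H                                                  ≡⟨ sum-cong-≗ {n} (λ x → sum-δ (block x) (H x)) ⟨
  sum (λ x → sum (λ i → [ block x FinP.≟ i ]· H x))      ≡⟨ ∑-comm (λ x i → [ block x FinP.≟ i ]· H x) ⟩
  sum (λ i → sum (λ x → [ block x FinP.≟ i ]· H x))      ≡⟨ sum-cong-≗ {k} block-sum ⟩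
  sum (λ i → sum (H ∘ embed i))                          ∎
  where
  open ≡-Reasoning
  open Blocks B
  open BlockFacts B
  all-true : ∀ {m} → Fin m → Dec ⊤
  all-true _ = yes tt
  block-sum : ∀ i → sum (λ x → [ block x FinP.≟ i ]· H x) ≡ sum (H ∘ embed i)
  block-sum i = begin
    sum (λ x → [ block x FinP.≟ i ]· H x)
      ≡⟨ sumList-allFin n _ ⟨
    sumList (allFin n) (λ x → [ block x FinP.≟ i ]· H x)
      ≡⟨ sumList-bijection (λ x → block x FinP.≟ i) all-true H (H ∘ embed i) (embed i)
           (Unique.allFin⁺ n) ∈.∈-allFin (Unique.allFin⁺ (size i)) ∈.∈-allFin
           (embed-injective i) (λ {a} _ → block-embed i a , refl)
           (λ {x} bx≡i → let a , eq = embed-onto′ i x bx≡i in a , tt , eq) ⟩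
    sumList (allFin (size i)) (λ a → [ all-true a ]· H (embed i a))
      ≡⟨ sumList-allFin (size i) _ ⟩
    sum (H ∘ embed i)
      ∎

first-element-weighted : ∀ {m} (R : DecRel m) (W : ℕ[ζ]) (c : Fin m → ℕ[ζ]) → (∀ a b → c a ≡ c b) →
  sum (λ a → [ minimal? R a ]· ((ζ^ (toℕ a) ⊗ Lζ (R ∖ a)) ⊗ (W ⊗ c a)))
  ≡ (Lζ R ⊗ W) ⊗ sum (λ a → [ toℕ a ℕ.≟ 0 ]· (ζ^ (toℕ a) ⊗ c a))
first-element-weighted {zero}  R W c c-const = sym (ℕ[ζ].zeroʳ (Lζ R ⊗ W))
first-element-weighted {suc m} R W c c-const = begin
  sum (λ a → [ minimal? R a ]· ((ζ^ (toℕ a) ⊗ Lζ (R ∖ a)) ⊗ (W ⊗ c a)))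
    ≡⟨ sum-cong-≗ {suc m} (λ a → trans (cong (λ ca → [ minimal? R a ]· ((ζ^ (toℕ a) ⊗ Lζ (R ∖ a)) ⊗ (W ⊗ ca))) (c-const a zero))
                                       (sym ([]·-⊗ (minimal? R a) (ζ^ (toℕ a) ⊗ Lζ (R ∖ a)) (W ⊗ c zero)))) ⟩
  sum (λ a → [ minimal? R a ]· (ζ^ (toℕ a) ⊗ Lζ (R ∖ a)) ⊗ (W ⊗ c zero))
    ≡⟨ *-distribʳ-sum (W ⊗ c zero) (λ a → [ minimal? R a ]· (ζ^ (toℕ a) ⊗ Lζ (R ∖ a))) ⟨
  sum (λ a → [ minimal? R a ]· (ζ^ (toℕ a) ⊗ Lζ (R ∖ a))) ⊗ (W ⊗ c zero)
    ≡⟨ cong (_⊗ (W ⊗ c zero)) (L-first-element R) ⟨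
  Lζ R ⊗ (W ⊗ c zero)
    ≡⟨ ℕ[ζ].*-assoc (Lζ R) W (c zero) ⟨
  (Lζ R ⊗ W) ⊗ c zero
    ≡⟨ cong ((Lζ R ⊗ W) ⊗_) only-zero ⟨
  (Lζ R ⊗ W) ⊗ sum (λ a → [ toℕ a ℕ.≟ 0 ]· (ζ^ (toℕ a) ⊗ c a))
    ∎
  where
  open ≡-Reasoning
  only-zero : sum (λ a → [ toℕ a ℕ.≟ 0 ]· (ζ^ (toℕ a) ⊗ c a)) ≡ c zero
  only-zero = trans (cong₂ _⊕_ (ℕ[ζ].*-identityˡ (c zero))
                               (trans (sum-cong-≗ {m} (λ a → [no]· (toℕ (suc a) ℕ.≟ 0) (λ ()) (ζ^ (toℕ (suc a)) ⊗ c (suc a)))) (sum-replicate-zero m)))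
                    (ℕ[ζ].+-identityʳ (c zero))

module FactorizationStep {n k} (B : Blocks (suc n) k) (Q : DecRel k) (R C : DecRel (suc n))
  (R-between : AgreesBetween B Q R) (C-between : AgreesBetween B Q C) (C-chain : ChainWithin B C)
  (hypothesis : ∀ (B′ : Blocks n k) (R′ C′ : DecRel n) → AgreesBetween B′ Q R′ → AgreesBetween B′ Q C′ →
                ChainWithin B′ C′ → Lζ R′ ≡ ∏ (Lζ ∘ restrict B′ R′) ⊗ Lζ C′) where
  open Blocks B
  open BlockFacts B
  open Equivalence using (to; from)

  -- if x' ≤ y < x with x, x' in one block, then punchIn x y = y and
  -- punchIn x' y = y + 1 lie between x' and x, hence in that block too
  block-punchIn-mixed : ∀ {x x' : Fin (suc n)} → block x ≡ block x' → ∀ y → toℕ y ℕ.< toℕ x → ¬ toℕ y ℕ.< toℕ x' →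
                        block (punchIn x y) ≡ block (punchIn x' y)
  block-punchIn-mixed {x = x} {x'} same y y<x y≮x' =
    trans (block-convex x' (punchIn x y) x (subst (toℕ x' ℕ.≤_) (sym y-pos) x'≤y) (subst (ℕ._≤ toℕ x) (sym y-pos) (ℕP.<⇒≤ y<x)) (sym same))
          (sym (block-convex x' (punchIn x' y) x (subst (toℕ x' ℕ.≤_) (sym y+1-pos) (ℕP.m≤n⇒m≤1+n x'≤y))
                                                 (subst (ℕ._≤ toℕ x) (sym y+1-pos) y<x) (sym same)))
    where
    x'≤y = ℕP.≮⇒≥ y≮x'
    y-pos = toℕ-punchIn-< x y y<x
    y+1-pos = toℕ-punchIn-≥ x' y x'≤y

  block-punchIn : ∀ {x x' : Fin (suc n)} → block x ≡ block x' → ∀ y → block (punchIn x y) ≡ block (punchIn x' y)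
  block-punchIn {x = x} {x'} same y with toℕ y ℕ.<? toℕ x | toℕ y ℕ.<? toℕ x'
  ... | yes y<x | yes y<x' = cong block (FinP.toℕ-injective (trans (toℕ-punchIn-< x y y<x) (sym (toℕ-punchIn-< x' y y<x'))))
  ... | no y≮x  | no y≮x'  = cong block (FinP.toℕ-injective (trans (toℕ-punchIn-≥ x y (ℕP.≮⇒≥ y≮x)) (sym (toℕ-punchIn-≥ x' y (ℕP.≮⇒≥ y≮x')))))
  ... | yes y<x | no y≮x'  = block-punchIn-mixed same y y<x y≮x'
  ... | no y≮x  | yes y<x' = sym (block-punchIn-mixed (sym same) y y<x' y≮x)

  FirstBlock : Fin k → Set
  FirstBlock i = ∀ y → block y ≢ i → ¬ rel Q (block y) i

  firstBlock? : ∀ i → Dec (FirstBlock i)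
  firstBlock? i = FinP.all? (λ y → ¬? (block y FinP.≟ i) →-dec ¬? (DecRel.rel? Q (block y) i))

  minimal⇒first : ∀ S → AgreesBetween B Q S → ∀ i a → Minimal S (embed i a) → FirstBlock i
  minimal⇒first S S-between i a min y by≢i yQi = min y (λ eq → by≢i (trans (cong block eq) (block-embed i a)))
    (from (S-between y (embed i a) (by≢i ∘ (_⟨ trans ⟩ block-embed i a))) (subst (rel Q (block y)) (sym (block-embed i a)) yQi))

  first⇒no-other-below : ∀ S → AgreesBetween B Q S → ∀ i a → FirstBlock i → ∀ y → block y ≢ i → ¬ rel S y (embed i a)
  first⇒no-other-below S S-between i a first y by≢i ySx =
    first y by≢i (subst (rel Q (block y)) (block-embed i a) (to (S-between y (embed i a) (by≢i ∘ (_⟨ trans ⟩ block-embed i a))) ySx))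

  minimal-in-R⇒ : ∀ i a → Minimal R (embed i a) → FirstBlock i × Minimal (restrict B R i) a
  minimal-in-R⇒ i a min = minimal⇒first R R-between i a min , λ b b≢a → min (embed i b) (b≢a ∘ embed-injective i)

  minimal-in-R⇐ : ∀ i a → FirstBlock i × Minimal (restrict B R i) a → Minimal R (embed i a)
  minimal-in-R⇐ i a (first , min) y y≢x ySx with block y FinP.≟ i
  ... | yes refl = let b , eq = embed-onto y in
                   min b (λ b≡a → y≢x (trans (sym eq) (cong (embed (block y)) b≡a))) (subst (λ z → rel R z (embed (block y) a)) (sym eq) ySx)
  ... | no by≢i  = first⇒no-other-below R R-between i a first y by≢i ySx

  minimal-in-C⇒ : ∀ i a → Minimal C (embed i a) → FirstBlock i × toℕ a ≡ 0
  minimal-in-C⇒ i a min = minimal⇒first C C-between i a min , least-position (toℕ a ℕ.≟ 0)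
    where
    least-position : Dec (toℕ a ≡ 0) → toℕ a ≡ 0
    least-position (yes a≡0) = a≡0
    least-position (no a≢0)  = ⊥-elim (min (embed i (least a)) (a≢0 ∘ least≡a) (from (C-chain _ _ same-block) first≤x))
      where
      least≡a : embed i (least a) ≡ embed i a → toℕ a ≡ 0
      least≡a eq = trans (cong toℕ (sym (embed-injective i eq))) (toℕ-least a)
      same-block = trans (block-embed i (least a)) (sym (block-embed i a))
      first≤x : toℕ (embed i (least a)) ℕ.≤ toℕ (embed i a)
      first≤x = subst₂ ℕ._≤_ (sym (trans (toℕ-embed i (least a)) (cong (offset i +_) (toℕ-least a))))
                              (sym (toℕ-embed i a)) (ℕP.+-monoʳ-≤ (offset i) z≤n)

  minimal-in-C⇐ : ∀ i a → FirstBlock i × toℕ a ≡ 0 → Minimal C (embed i a)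
  minimal-in-C⇐ i a (first , a≡0) y y≢x yCx with block y FinP.≟ i
  ... | yes refl = let b , eq = embed-onto y
                       b≤a = ℕP.+-cancelˡ-≤ (offset (block y)) _ _ (subst₂ ℕ._≤_ (trans (cong toℕ (sym eq)) (toℕ-embed _ b)) (toℕ-embed _ a)
                               (to (C-chain y (embed (block y) a) (sym (block-embed _ a))) yCx))
                   in y≢x (trans (sym eq) (cong (embed (block y)) (FinP.toℕ-injective (ℕP.n≤0⇒n≡0 (subst (toℕ b ℕ.≤_) a≡0 b≤a) ⟨ trans ⟩ sym a≡0))))
  ... | no by≢i  = first⇒no-other-below C C-between i a first y by≢i yCx

  C-deletion-independent : ∀ i a a' → Lζ (C ∖ embed i a) ≡ Lζ (C ∖ embed i a')
  C-deletion-independent i a a' = Lζ-cong (C ∖ x) (C ∖ x') (transfer x x' same) (transfer x' x (sym same))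
    where
    x = embed i a
    x' = embed i a'
    same = trans (block-embed i a) (sym (block-embed i a'))
    transfer : ∀ x x' → block x ≡ block x' → ∀ {y z} → rel C (punchIn x y) (punchIn x z) → rel C (punchIn x' y) (punchIn x' z)
    transfer x x' same {y} {z} yCz with block (punchIn x y) FinP.≟ block (punchIn x z)
    ... | yes eq = from (C-chain _ _ (trans (sym (block-punchIn same y)) (trans eq (block-punchIn same z))))
                        (FinP.punchIn-mono-≤ x' y z (FinP.punchIn-cancel-≤ x y z (to (C-chain _ _ eq) yCz)))
    ... | no neq = from (C-between _ _ (λ eq → neq (trans (block-punchIn same y) (trans eq (sym (block-punchIn same z))))))
                        (subst₂ (rel Q) (block-punchIn same y) (block-punchIn same z) (to (C-between _ _ neq) yCz))

  Π : ℕ[ζ]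
  Π = ∏ (Lζ ∘ restrict B R)

  rest : Fin k → ℕ[ζ]
  rest i = ∏ ((Lζ ∘ restrict B R) [ i ≔ 𝟙 ])

  h : ∀ i → Fin (size i) → ℕ[ζ]
  h i a = Lζ (C ∖ embed i a)

  F G : Fin (suc n) → ℕ[ζ]
  F x = [ minimal? R x ]· (ζ^ (toℕ x) ⊗ Lζ (R ∖ x))
  G x = [ minimal? C x ]· (ζ^ (toℕ x) ⊗ Lζ (C ∖ x))

  ζ^-embed : ∀ i a → ζ^ (toℕ (embed i a)) ≡ ζ^ (offset i) ⊗ ζ^ (toℕ a)
  ζ^-embed i a = trans (cong ζ^ (toℕ-embed i a)) (ζ^-+ (offset i) (toℕ a))

  L-deletion : ∀ i a → Lζ (R ∖ embed i a) ≡ (Lζ (restrict B R i ∖ a) ⊗ rest i) ⊗ h i a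
  L-deletion i a = begin
    Lζ (R ∖ x)
      ≡⟨ hypothesis blocks (R ∖ x) (C ∖ x) (λ y z → R-between (punchIn x y) (punchIn x z))
                    (λ y z → C-between (punchIn x y) (punchIn x z)) chain′ ⟩
    ∏ (Lζ ∘ restrict blocks (R ∖ x)) ⊗ h i a
      ≡⟨ cong (_⊗ h i a) (Πζ.sum-cong-≗ (L-restrict-deletion R)) ⟩
    ∏ ((Lζ ∘ restrict B R) [ i ≔ Lζ (restrict B R i ∖ a) ]) ⊗ h i a
      ≡⟨ cong (_⊗ h i a) (∏-update (Lζ ∘ restrict B R) i _) ⟩
    (Lζ (restrict B R i ∖ a) ⊗ rest i) ⊗ h i a
      ∎
    where
    open ≡-Reasoning
    open Deletion B i a using (x; blocks; L-restrict-deletion)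
    chain′ : ChainWithin blocks (C ∖ x)
    chain′ y z same = mk⇔ (FinP.punchIn-cancel-≤ x y z ∘ to (C-chain _ _ same))
                          (from (C-chain _ _ same) ∘ FinP.punchIn-mono-≤ x y z)

  F-block : ∀ i a → F (embed i a) ≡ [ firstBlock? i ]· ([ minimal? (restrict B R i) a ]·
              ((ζ^ (toℕ a) ⊗ Lζ (restrict B R i ∖ a)) ⊗ (rest i ⊗ (ζ^ (offset i) ⊗ h i a))))
  F-block i a = begin
    [ minimal? R (embed i a) ]· (ζ^ (toℕ (embed i a)) ⊗ Lζ (R ∖ embed i a))
      ≡⟨ []·-cong (minimal? R (embed i a)) (firstBlock? i ×-dec minimal? (restrict B R i) a)
                  (minimal-in-R⇒ i a) (minimal-in-R⇐ i a) _ ⟩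
    [ firstBlock? i ×-dec minimal? (restrict B R i) a ]· (ζ^ (toℕ (embed i a)) ⊗ Lζ (R ∖ embed i a))
      ≡⟨ []·-×-dec (firstBlock? i) (minimal? (restrict B R i) a) _ ⟩
    [ firstBlock? i ]· ([ minimal? (restrict B R i) a ]· (ζ^ (toℕ (embed i a)) ⊗ Lζ (R ∖ embed i a)))
      ≡⟨ cong (λ t → [ firstBlock? i ]· ([ minimal? (restrict B R i) a ]· t))
              (trans (cong₂ _⊗_ (ζ^-embed i a) (L-deletion i a)) (regroup (ζ^ (offset i)) (ζ^ (toℕ a)) _ (rest i) (h i a))) ⟩
    [ firstBlock? i ]· ([ minimal? (restrict B R i) a ]· ((ζ^ (toℕ a) ⊗ Lζ (restrict B R i ∖ a)) ⊗ (rest i ⊗ (ζ^ (offset i) ⊗ h i a))))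
      ∎
    where
    open ≡-Reasoning
    regroup : ∀ o p l r c → (o ⊗ p) ⊗ ((l ⊗ r) ⊗ c) ≡ (p ⊗ l) ⊗ (r ⊗ (o ⊗ c))
    regroup = solve 5 (λ o p l r c → (o · p) · ((l · r) · c) ⊜ (p · l) · (r · (o · c))) refl

  G-block : ∀ i a → G (embed i a) ≡ [ firstBlock? i ]· ([ toℕ a ℕ.≟ 0 ]· (ζ^ (toℕ a) ⊗ (ζ^ (offset i) ⊗ h i a)))
  G-block i a = begin
    [ minimal? C (embed i a) ]· (ζ^ (toℕ (embed i a)) ⊗ h i a)
      ≡⟨ []·-cong (minimal? C (embed i a)) (firstBlock? i ×-dec (toℕ a ℕ.≟ 0)) (minimal-in-C⇒ i a) (minimal-in-C⇐ i a) _ ⟩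
    [ firstBlock? i ×-dec (toℕ a ℕ.≟ 0) ]· (ζ^ (toℕ (embed i a)) ⊗ h i a)
      ≡⟨ []·-×-dec (firstBlock? i) (toℕ a ℕ.≟ 0) _ ⟩
    [ firstBlock? i ]· ([ toℕ a ℕ.≟ 0 ]· (ζ^ (toℕ (embed i a)) ⊗ h i a))
      ≡⟨ cong (λ t → [ firstBlock? i ]· ([ toℕ a ℕ.≟ 0 ]· t))
              (trans (cong (_⊗ h i a) (ζ^-embed i a))
                     (trans (ℕ[ζ].*-assoc (ζ^ (offset i)) (ζ^ (toℕ a)) (h i a)) (x∙yz≈y∙xz (ζ^ (offset i)) (ζ^ (toℕ a)) (h i a)))) ⟩
    [ firstBlock? i ]· ([ toℕ a ℕ.≟ 0 ]· (ζ^ (toℕ a) ⊗ (ζ^ (offset i) ⊗ h i a)))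
      ∎
    where open ≡-Reasoning

  block-identity : ∀ i → sum (F ∘ embed i) ≡ Π ⊗ sum (G ∘ embed i)
  block-identity i = begin
    sum (F ∘ embed i)
      ≡⟨ sum-cong-≗ {size i} (F-block i) ⟩
    sum (λ a → [ firstBlock? i ]· ([ minimal? Rᵢ a ]· ((ζ^ (toℕ a) ⊗ Lζ (Rᵢ ∖ a)) ⊗ (rest i ⊗ c a))))
      ≡⟨ sum-[]· (firstBlock? i) (λ a → [ minimal? Rᵢ a ]· ((ζ^ (toℕ a) ⊗ Lζ (Rᵢ ∖ a)) ⊗ (rest i ⊗ c a))) ⟩
    [ firstBlock? i ]· sum (λ a → [ minimal? Rᵢ a ]· ((ζ^ (toℕ a) ⊗ Lζ (Rᵢ ∖ a)) ⊗ (rest i ⊗ c a)))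
      ≡⟨ cong ([ firstBlock? i ]·_) (first-element-weighted Rᵢ (rest i) c (λ a b → cong (ζ^ (offset i) ⊗_) (C-deletion-independent i a b))) ⟩
    [ firstBlock? i ]· ((Lζ Rᵢ ⊗ rest i) ⊗ S)
      ≡⟨ cong (λ t → [ firstBlock? i ]· (t ⊗ S)) (∏-extract (Lζ ∘ restrict B R) i) ⟨
    [ firstBlock? i ]· (Π ⊗ S)
      ≡⟨ ⊗-[]· (firstBlock? i) Π S ⟨
    Π ⊗ [ firstBlock? i ]· S
      ≡⟨ cong (Π ⊗_) (sum-[]· (firstBlock? i) (λ a → [ toℕ a ℕ.≟ 0 ]· (ζ^ (toℕ a) ⊗ c a))) ⟨
    Π ⊗ sum (λ a → [ firstBlock? i ]· ([ toℕ a ℕ.≟ 0 ]· (ζ^ (toℕ a) ⊗ c a)))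
      ≡⟨ cong (Π ⊗_) (sum-cong-≗ {size i} (G-block i)) ⟨
    Π ⊗ sum (G ∘ embed i)
      ∎
    where
    open ≡-Reasoning
    Rᵢ = restrict B R i
    c = λ a → ζ^ (offset i) ⊗ h i a
    S = sum (λ a → [ toℕ a ℕ.≟ 0 ]· (ζ^ (toℕ a) ⊗ c a))

  step : Lζ R ≡ Π ⊗ Lζ C
  step = begin
    Lζ R                                  ≡⟨ L-first-element R ⟩
    sum F                                 ≡⟨ sum-by-blocks B F ⟩
    sum (λ i → sum (F ∘ embed i))         ≡⟨ sum-cong-≗ {k} block-identity ⟩
    sum (λ i → Π ⊗ sum (G ∘ embed i))     ≡⟨ *-distribˡ-sum Π (λ i → sum (G ∘ embed i)) ⟨
    Π ⊗ sum (λ i → sum (G ∘ embed i))     ≡⟨ cong (Π ⊗_) (sum-by-blocks B G) ⟨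
    Π ⊗ sum G                             ≡⟨ cong (Π ⊗_) (L-first-element C) ⟨
    Π ⊗ Lζ C                              ∎
    where open ≡-Reasoning

block-factorization : ∀ n {k} (B : Blocks n k) (Q : DecRel k) (R C : DecRel n) →
  AgreesBetween B Q R → AgreesBetween B Q C → ChainWithin B C → Lζ R ≡ ∏ (Lζ ∘ restrict B R) ⊗ Lζ C
block-factorization zero {k} B Q R C _ _ _ =
  sym (cong (_⊗ 𝟙) (trans (Πζ.sum-cong-≗ (λ i → Lζ-empty (restrict B R i) (no-elements (Blocks.embed B i))))
                          (Πζ.sum-replicate-zero k)))
  where
  Lζ-empty : ∀ {m} (S : DecRel m) → m ≡ 0 → Lζ S ≡ 𝟙
  Lζ-empty S refl = refl
  no-elements : ∀ {m} → (Fin m → Fin 0) → m ≡ 0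
  no-elements {zero}  _ = refl
  no-elements {suc m} f with () ← f zero
block-factorization (suc n) B Q R C R-between C-between C-chain =
  FactorizationStep.step B Q R C R-between C-between C-chain (λ B′ → block-factorization n B′ Q)

offsets : (k : ℕ) (m : Fin k → ℕ) → Fin k → ℕ
offsets (suc k) m zero    = 0
offsets (suc k) m (suc i) = m zero + offsets k (m ∘ suc) i

encode : (k : ℕ) (m : Fin k → ℕ) (i : Fin k) → Fin (m i) → Fin (total k m)
encode (suc k) m zero    a = a Fin.↑ˡ total k (m ∘ suc)
encode (suc k) m (suc i) a = m zero Fin.↑ʳ encode k (m ∘ suc) i a

decode-encode : ∀ k m (i : Fin k) (a : Fin (m i)) → decode k m (encode k m i a) ≡ (i , a)
decode-encode (suc k) m zero    a rewrite FinP.splitAt-↑ˡ (m zero) a (total k (m ∘ suc)) = refl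
decode-encode (suc k) m (suc i) a
  rewrite FinP.splitAt-↑ʳ (m zero) (total k (m ∘ suc)) (encode k (m ∘ suc) i a)
        | decode-encode k (m ∘ suc) i a = refl

encode-decode : ∀ k m (x : Fin (total k m)) → encode k m (proj₁ (decode k m x)) (proj₂ (decode k m x)) ≡ x
encode-decode (suc k) m x with splitAt (m zero) x in eq
... | inj₁ a = FinP.splitAt⁻¹-↑ˡ eq
... | inj₂ y with decode k (m ∘ suc) y | encode-decode k (m ∘ suc) y
...   | i , a | ih = trans (cong (m zero Fin.↑ʳ_) ih) (FinP.splitAt⁻¹-↑ʳ eq)

toℕ-encode : ∀ k m (i : Fin k) (a : Fin (m i)) → toℕ (encode k m i a) ≡ offsets k m i + toℕ a
toℕ-encode (suc k) m zero    a = FinP.toℕ-↑ˡ a (total k (m ∘ suc))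
toℕ-encode (suc k) m (suc i) a = begin
  toℕ (m zero Fin.↑ʳ encode k (m ∘ suc) i a)   ≡⟨ FinP.toℕ-↑ʳ (m zero) (encode k (m ∘ suc) i a) ⟩
  m zero + toℕ (encode k (m ∘ suc) i a)        ≡⟨ cong (m zero +_) (toℕ-encode k (m ∘ suc) i a) ⟩
  m zero + (offsets k (m ∘ suc) i + toℕ a)     ≡⟨ ℕP.+-assoc (m zero) _ _ ⟨
  m zero + offsets k (m ∘ suc) i + toℕ a       ∎
  where open ≡-Reasoning

offsets-mono : ∀ k m (i i' : Fin k) → toℕ i ℕ.< toℕ i' → offsets k m i + m i ℕ.≤ offsets k m i'
offsets-mono (suc k) m zero    (suc i') _         = ℕP.m≤m+n (m zero) _
offsets-mono (suc k) m (suc i) (suc i') (s≤s i<i') =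
  subst (ℕ._≤ m zero + offsets k (m ∘ suc) i') (sym (ℕP.+-assoc (m zero) _ _))
        (ℕP.+-monoʳ-≤ (m zero) (offsets-mono k (m ∘ suc) i i' i<i'))

module LexBlocks (k : ℕ) (m : Fin k → ℕ) where

  lex-block : Fin (total k m) → Fin k
  lex-block x = proj₁ (decode k m x)

  toℕ-decode : ∀ x → toℕ x ≡ offsets k m (lex-block x) + toℕ (proj₂ (decode k m x))
  toℕ-decode x = trans (cong toℕ (sym (encode-decode k m x))) (toℕ-encode k m _ _)

  lex-block-mono : ∀ x y → toℕ x ℕ.≤ toℕ y → toℕ (lex-block x) ℕ.≤ toℕ (lex-block y)
  lex-block-mono x y x≤y = ℕP.≮⇒≥ λ by<bx → ℕP.<⇒≱
    (ℕP.<-≤-trans (subst (ℕ._< offsets k m (lex-block y) + m (lex-block y)) (sym (toℕ-decode y))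
                         (ℕP.+-monoʳ-< (offsets k m (lex-block y)) (FinP.toℕ<n _)))
                  (ℕP.≤-trans (offsets-mono k m _ _ by<bx) (subst (offsets k m (lex-block x) ℕ.≤_) (sym (toℕ-decode x)) (ℕP.m≤m+n _ _))))
    x≤y

  lexBlocks : Blocks (total k m) k
  lexBlocks = record
    { size        = m
    ; offset      = offsets k m
    ; block       = lex-block
    ; embed       = encode k m
    ; block-embed = λ i a → cong proj₁ (decode-encode k m i a)
    ; toℕ-embed   = toℕ-encode k m
    ; embed-onto  = λ x → proj₂ (decode k m x) , encode-decode k m x
    ; block-mono  = lex-block-mono
    }

module LexicographicSum {k} (m : Fin k → ℕ) (P₀ : FinPoset k) (Ps : ∀ i → FinPoset (m i)) where
  open LexBlocks k m

  lex-between : ∀ (Ss : ∀ i → FinPoset (m i)) → AgreesBetween lexBlocks (poset→rel P₀) (lexSum P₀ Ss)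
  lex-between Ss x y bx≢by = mk⇔ (λ { (inj₁ (_ , q)) → q ; (inj₂ (eq , _)) → ⊥-elim (bx≢by eq) }) (λ q → inj₁ (bx≢by , q))

  lex-chain : ChainWithin lexBlocks (lexSum {m = m} P₀ (λ i → chain (m i)))
  lex-chain x y same = mk⇔
    (λ { (inj₁ (ne , _))   → ⊥-elim (ne same)
       ; (inj₂ (eq , a≤b)) → subst₂ ℕ._≤_ (sym (toℕ-decode x)) (sym (toℕ-decode y)) (shift⁺ eq a≤b) })
    (λ x≤y → inj₂ (same , shift⁻ same (subst₂ ℕ._≤_ (toℕ-decode x) (toℕ-decode y) x≤y)))
    where
    shift⁺ : ∀ {i i'} (eq : i ≡ i') {a : Fin (m i)} {b : Fin (m i')} →
             toℕ (subst (λ t → Fin (m t)) eq a) ℕ.≤ toℕ b → offsets k m i + toℕ a ℕ.≤ offsets k m i' + toℕ b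
    shift⁺ {i} refl = ℕP.+-monoʳ-≤ (offsets k m i)
    shift⁻ : ∀ {i i'} (eq : i ≡ i') {a : Fin (m i)} {b : Fin (m i')} →
             offsets k m i + toℕ a ℕ.≤ offsets k m i' + toℕ b → toℕ (subst (λ t → Fin (m t)) eq a) ℕ.≤ toℕ b
    shift⁻ {i} refl = ℕP.+-cancelˡ-≤ (offsets k m i) _ _

  L-restrict-lex : ∀ i → Lζ (restrict lexBlocks (lexSum P₀ Ps) i) ≡ Lζ (poset→rel (Ps i))
  L-restrict-lex i = Lζ-cong (restrict lexBlocks (lexSum P₀ Ps) i) (poset→rel (Ps i))
    (λ {a} {b} r → inside (subst₂ (lexRelΣ P₀ Ps) (decode-encode k m i a) (decode-encode k m i b) r))
    (λ {a} {b} p → subst₂ (lexRelΣ P₀ Ps) (sym (decode-encode k m i a)) (sym (decode-encode k m i b)) (inj₂ (refl , p)))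
    where
    inside : ∀ {a b} → lexRelΣ P₀ Ps (i , a) (i , b) → FinPoset._≼_ (Ps i) a b
    inside (inj₁ (i≢i , _)) = ⊥-elim (i≢i refl)
    inside (inj₂ (refl , p)) = p

  lex-factorization : Lζ (lexSum P₀ Ps) ≡ ∏ (λ i → Lζ (poset→rel (Ps i))) ⊗ Lζ (lexSum {m = m} P₀ (λ i → chain (m i)))
  lex-factorization = trans
    (block-factorization (total k m) lexBlocks (poset→rel P₀) (lexSum P₀ Ps) Pch (lex-between Ps) (lex-between (λ i → chain (m i))) lex-chain)
    (cong (_⊗ Lζ Pch) (Πζ.sum-cong-≗ L-restrict-lex))
    where Pch = lexSum {m = m} P₀ (λ i → chain (m i))

toℤζ : ℕ[ζ] → ℤζ
toℤζ (a , b) = ℤ.+ a , ℤ.+ b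

toℤζ-⊗ : ∀ x y → toℤζ (x ⊗ y) ≡ toℤζ x ·ζ toℤζ y
toℤζ-⊗ (a , b) (c , d) = cong₂ _,_
  (trans (ℤP.pos-+ (a * c) (b * d)) (cong₂ ℤ._+_ (ℤP.pos-* a c) (ℤP.pos-* b d)))
  (trans (ℤP.pos-+ (a * d) (b * c)) (cong₂ ℤ._+_ (ℤP.pos-* a d) (ℤP.pos-* b c)))

toℤζ-∏ : ∀ k (f : Fin k → ℕ[ζ]) → toℤζ (∏ f) ≡ ∏ζ k (toℤζ ∘ f)
toℤζ-∏ zero    f = refl
toℤζ-∏ (suc k) f = trans (toℤζ-⊗ (f zero) (∏ (f ∘ suc))) (cong (toℤζ (f zero) ·ζ_) (toℤζ-∏ k (f ∘ suc)))

φ₊ φ₋ : ℤζ → ℤ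
φ₊ (a , b) = a ℤ.+ b
φ₋ (a , b) = a ℤ.- b

φ₊-· : ∀ x y → φ₊ (x ·ζ y) ≡ φ₊ x ℤ.* φ₊ y
φ₊-· (a , b) (c , d) = lemma a b c d
  where
  lemma : ∀ a b c d → (a ℤ.* c ℤ.+ b ℤ.* d) ℤ.+ (a ℤ.* d ℤ.+ b ℤ.* c) ≡ (a ℤ.+ b) ℤ.* (c ℤ.+ d)
  lemma = solveℤ

φ₋-· : ∀ x y → φ₋ (x ·ζ y) ≡ φ₋ x ℤ.* φ₋ y
φ₋-· (a , b) (c , d) = lemma a b c d
  where
  lemma : ∀ a b c d → (a ℤ.* c ℤ.+ b ℤ.* d) ℤ.- (a ℤ.* d ℤ.+ b ℤ.* c) ≡ (a ℤ.- b) ℤ.* (c ℤ.- d)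
  lemma = solveℤ

∏-hom : (φ : ℤζ → ℤ) → (∀ x y → φ (x ·ζ y) ≡ φ x ℤ.* φ y) → φ oneζ ≡ ℤ.+ 1 →
        ∀ k (f : Fin k → ℤζ) → φ (∏ζ k f) ≡ ∏ℤ k (φ ∘ f)
∏-hom φ φ-· φ-1 zero    f = φ-1
∏-hom φ φ-· φ-1 (suc k) f = trans (φ-· (f zero) (∏ζ k (f ∘ suc))) (cong (φ (f zero) ℤ.*_) (∏-hom φ φ-· φ-1 k (f ∘ suc)))

∏²-split : ∀ k (u v : Fin k → ℤ) → ∏² k (λ i → u i , v i) ≡ (∏ℤ k u , ∏ℤ k v)
∏²-split zero    u v = refl
∏²-split (suc k) u v = cong (λ p → u zero ℤ.* proj₁ p , v zero ℤ.* proj₂ p) (∏²-split k (u ∘ suc) (v ∘ suc))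

theorem4p2 : (m₀ : ℕ) (P₀ : FinPoset m₀) (m : Fin m₀ → ℕ) (Ps : (i : Fin m₀) → FinPoset (m i)) →
    (L (lexSum P₀ Ps) ≡ ∏ζ m₀ (λ i → L (poset→rel (Ps i))) ·ζ L (lexSum {m = m} P₀ (λ i → chain (m i))))
    × (L± (lexSum P₀ Ps) ≡ ∏² m₀ (λ i → L± (poset→rel (Ps i))) ·² L± (lexSum {m = m} P₀ (λ i → chain (m i))))
    × (L₊ (lexSum P₀ Ps) ≡ ∏ℤ m₀ (λ i → L₊ (poset→rel (Ps i))) Data.Integer.* L₊ (lexSum {m = m} P₀ (λ i → chain (m i))))
    × (L₋ (lexSum P₀ Ps) ≡ ∏ℤ m₀ (λ i → L₋ (poset→rel (Ps i))) Data.Integer.* L₋ (lexSum {m = m} P₀ (λ i → chain (m i))))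
theorem4p2 m₀ P₀ m Ps = L-eq , L±-eq , L₊-eq , L₋-eq
  where
  P = lexSum P₀ Ps
  Pch = lexSum {m = m} P₀ (λ i → chain (m i))
  Πᵢ = ∏ζ m₀ (λ i → L (poset→rel (Ps i)))
  L-eq : L P ≡ Πᵢ ·ζ L Pch
  L-eq = trans (cong toℤζ (LexicographicSum.lex-factorization m P₀ Ps))
               (trans (toℤζ-⊗ (∏ (λ i → Lζ (poset→rel (Ps i)))) (Lζ Pch))
                      (cong (_·ζ L Pch) (toℤζ-∏ m₀ (λ i → Lζ (poset→rel (Ps i))))))
  L₊-eq : L₊ P ≡ ∏ℤ m₀ (λ i → L₊ (poset→rel (Ps i))) ℤ.* L₊ Pch
  L₊-eq = trans (cong φ₊ L-eq) (trans (φ₊-· Πᵢ (L Pch)) (cong (ℤ._* L₊ Pch) (∏-hom φ₊ φ₊-· refl m₀ _)))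
  L₋-eq : L₋ P ≡ ∏ℤ m₀ (λ i → L₋ (poset→rel (Ps i))) ℤ.* L₋ Pch
  L₋-eq = trans (cong φ₋ L-eq) (trans (φ₋-· Πᵢ (L Pch)) (cong (ℤ._* L₋ Pch) (∏-hom φ₋ φ₋-· refl m₀ _)))
  L±-eq : L± P ≡ ∏² m₀ (λ i → L± (poset→rel (Ps i))) ·² L± Pch
  L±-eq = trans (cong₂ _,_ L₊-eq L₋-eq) (cong (_·² L± Pch) (sym (∏²-split m₀ _ _)))
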